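{- Let $k\ge0$. For all $i\ge1$: (i) for all $1\le r\le f_{2k+1}$ and $1\le r'\le f_{2k+2}$, \[H_{\alpha_i-f_{2k+3}+r',\,f_{2k}}=H_{\beta'_i+r,\,f_{2k}}=H_{\alpha_1-f_{2k},\,f_{2k}};\] (ii) $H_{\gamma_i-f_{2k+2}+r,\,f_{2k+1}}=(-1)^{r+1}H_{\gamma_1-f_{2k+1},\,f_{2k+1}}$ for all $1\le r\le f_{2k}$ with $\gamma_i-f_{2k+2}+r\ge0$.
   Context: Let $\tau$ be the substitution on $\{0,1\}$ with $\tau(1)=101$, $\tau(0)=1$ (extended to words by concatenation), and let $\mathbf{s}=(s_j)_{j\ge 0}=\lim_{j\to\infty}\tau^j(1)$ be its fixed point beginning with $1$. For $m\ge 0$, $n\ge 1$, $H_{m,n}=\det(s_{m+i+j})_{0\le i,j\le n-1}$. Define $f_{2j}=|\tau^j(1)|$, $f_{2j+1}=|\tau^j(10)|$; equivalently $f_0=1$, $f_1=2$, $f_{2j+2}=f_{2j}+f_{2j+1}$, $f_{2j+3}=f_{2j}+f_{2j+2}$; the $f_{2j+1}$ are even. Every integer $n\ge0$ has a unique representation $n=\sum_{i\ge0}a_i(n)f_i$ with $a_i(n)\in\{0,1\}$, finitely many nonzero, $a_ia_{i+1}=0$ for all $i$, and $a_ia_{i+2}=0$ for all even $i$. For $k\ge0$ put $\Phi_k(n)=\sum_{i=0}^{2k+2}a_i(n)f_i$. Let $\mathbb{N}=\{0,1,\dots\}$. For $k\ge 0$ let $E'_{k}=\{x\in\mathbb{N}:\Phi_k(x)=f_{2k+3}/2\}$,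 $F_k=\{y\in\mathbb{N}:\Phi_k(y)=f_{2k+1}/2\}$, $F'_k=\{y\in\mathbb{N}:\Phi_{k+1}(y)=f_{2k+1}/2\}$, $F''_k=F_k\setminus F'_k$. For fixed $k$, let $(\alpha_i)_{i\ge1}$, $(\beta'_i)_{i\ge1}$, $(\gamma_i)_{i\ge1}$ be the increasing enumerations of $E'_{k+1}$, $F''_k$, $E'_k$ respectively. -}

module Defs where

open import Data.Bool using (Bool; true; false; if_then_else_)
open import Data.Nat using (ℕ; zero; suc; _+_; _*_; _<_; ⌊_/2⌋)
open import Data.List using (List; []; _∷_; concatMap)
open import Data.Fin using (Fin; toℕ; punchIn)
import Data.Fin as Fin
open import Data.Integer using (ℤ; +_; -_) renaming (_+_ to _+ℤ_; _*_ to _*ℤ_)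
open import Data.Product using (Σ; _×_; ∃)
open import Relation.Binary.PropositionalEquality using (_≡_)
open import Relation.Nullary using (¬_)

-- The substitution τ(1) = 101, τ(0) = 1 on words over {0,1}
-- (true = 1, false = 0) and its fixed point s.

τ₁ : Bool → List Bool
τ₁ true  = true ∷ false ∷ true ∷ []
τ₁ false = true ∷ []

τ : List Bool → List Bool
τ = concatMap τ₁

τ^ : ℕ → List Bool → List Bool
τ^ zero    w = w
τ^ (suc j) w = τ (τ^ j w)

-- j-th letter of a word (0 if out of range; never used out of range below)
letter : List Bool → ℕ → Bool
letter []       _       = false
letter (b ∷ w)  zero    = b
letter (b ∷ w)  (suc j) = letter w j

-- s_j = the j-th letter of lim τ^n(1).  Since τ^n(1) is a prefix of
-- τ^(n+1)(1) and |τ^(j+1)(1)| > j, s_j is the j-th letter of τ^(j+1)(1).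
s : ℕ → ℤ
s j = if letter (τ^ (suc j) (true ∷ [])) j then + 1 else + 0

sgn : ℕ → ℤ
sgn zero    = + 1
sgn (suc n) = - sgn n

sumFin : ∀ {n} → (Fin n → ℤ) → ℤ
sumFin {zero}  g = + 0
sumFin {suc n} g = g Fin.zero +ℤ sumFin (λ i → g (Fin.suc i))

det : ∀ {n} → (Fin n → Fin n → ℤ) → ℤ
det {zero}  M = + 1
det {suc n} M =
  sumFin (λ i → sgn (toℕ i) *ℤ (M i Fin.zero *ℤ det (λ p q → M (punchIn i p) (Fin.suc q))))

H : ℕ → ℕ → ℤ
H m n = det {n} (λ i j → s (m + toℕ i + toℕ j))

-- The numbers f_i:  f_{2j} = fe j, f_{2j+1} = fo j.

fe fo : ℕ → ℕ
fe zero    = 1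
fe (suc j) = fe j + fo j
fo zero    = 2
fo (suc j) = fe j + fe (suc j)

fFrom : (ℕ → ℕ) → (ℕ → ℕ) → ℕ → ℕ
fFrom e o zero          = e zero
fFrom e o (suc zero)    = o zero
fFrom e o (suc (suc n)) = fFrom (λ j → e (suc j)) (λ j → o (suc j)) n

-- f_0 = 1, f_1 = 2, f_{2j+2} = f_{2j} + f_{2j+1}, f_{2j+3} = f_{2j} + f_{2j+2}
f : ℕ → ℕ
f = fFrom fe fo

-- Representations n = Σ a_i f_i with digits a_i ∈ {0,1}, given by a
-- finite list of digits (digit i = a_i, missing digits are 0).

digit : List Bool → ℕ → Bool
digit = letter

bit : Bool → ℕ
bit true  = 1
bit false = 0

partialVal : ℕ → List Bool → ℕ
partialVal zero    d = 0
partialVal (suc m) d = partialVal m d + bit (digit d m) * f m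

len : List Bool → ℕ
len []      = 0
len (_ ∷ w) = suc (len w)

value : List Bool → ℕ
value d = partialVal (len d) d

data Even : ℕ → Set where
  even0  : Even 0
  even+2 : ∀ {n} → Even n → Even (suc (suc n))

Admissible : List Bool → Set
Admissible d =
  (∀ i → ¬ (digit d i ≡ true × digit d (suc i) ≡ true)) ×
  (∀ i → Even i → ¬ (digit d i ≡ true × digit d (suc (suc i)) ≡ true))

IsRep : List Bool → ℕ → Set
IsRep d n = Admissible d × value d ≡ n

-- Φ_k(n) = v, where Φ_k(n) = Σ_{i=0}^{2k+2} a_i(n) f_i
PhiIs : ℕ → ℕ → ℕ → Set
PhiIs k n v = Σ (List Bool) (λ d → IsRep d n × partialVal (2 * k + 3) d ≡ v)

E' : ℕ → ℕ → Set
E' k x = PhiIs k x ⌊ f (2 * k + 3) /2⌋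

F : ℕ → ℕ → Set
F k y = PhiIs k y ⌊ f (2 * k + 1) /2⌋

F' : ℕ → ℕ → Set
F' k y = PhiIs (suc k) y ⌊ f (2 * k + 1) /2⌋

F'' : ℕ → ℕ → Set
F'' k y = F k y × ¬ F' k y

-- Increasing enumeration: Nth P i x  means  x is the i-th smallest
-- element (i ≥ 1) of {y ∈ ℕ : P y}.

data Nth (P : ℕ → Set) : ℕ → ℕ → Set where
  first : ∀ {x} → P x → (∀ y → y < x → ¬ P y) → Nth P 1 x
  next  : ∀ {i x' x} → Nth P i x' → x' < x → P x →
          (∀ y → x' < y → y < x → ¬ P y) → Nth P (suc i) x

-- Write A m = τᵐ(1) and Z m = τᵐ(0).  Then A (m+1) = A m · Z m · A m and Z (m+1) = A m, with
-- |A m| = f_{2m} and |A m · Z m| = f_{2m+1}; since every A m is a prefix of s this gives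
-- s_{f_{2m+1}+t} = s_t = s_{f_{2m+2}+t} for t < f_{2m}.  Cutting s into the blocks τᵐ(s_q),
-- the q-th block starts at the integer whose representation is that of q shifted by 2m
-- digits.  Hence every element of E'_k lies f_{2k+3}/2 letters into a block τ^{k+1}(1), and
-- every element of F''_k lies f_{2k+1}/2 letters into a block τ^{k+1}(1) that is followed
-- by another one.  Near such positions s is periodic with period f_{2k} (resp. f_{2k+1}) on
-- windows long enough for the Hankel matrices of that size, and on a periodic window
-- H_{m+1,n} = (-1)^{n-1} H_{m,n} because the matrix only undergoes a cyclic row rotation.
-- As f_{2k} is odd and f_{2k+1} even, the determinants stay constant, resp. alternate, while
-- the window slides; at the end of the slide the window lies in a part of s determined by
-- the block alone, so the value does not depend on the chosen element.

module Submission where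

open import Defs
open import Data.Bool using (Bool; true; false; not; if_then_else_)
open import Data.Nat using (ℕ; zero; suc; _+_; _*_; _∸_; _≤_; _<_; _≤′_; ≤′-reflexive; ≤′-step; z≤n; s≤s; ⌊_/2⌋)
open import Data.Nat.Properties
open import Data.Nat.Tactic.RingSolver using (solve-∀)
open import Data.Integer using (ℤ; 0ℤ; 1ℤ; -_) renaming (_+_ to _+ℤ_; _*_ to _*ℤ_)
import Data.Integer.Properties as ℤ
open import Data.Integer.Tactic.RingSolver renaming (solve-∀ to solve-∀ℤ)
open import Data.Fin using (Fin; toℕ; fromℕ; inject₁; punchIn)
import Data.Fin as Fin
open import Data.Fin.Properties using (toℕ-inject₁; toℕ-fromℕ; toℕ<n)
open import Data.List using (List; []; _∷_; _++_; length; drop)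
open import Data.List.Properties using (length-++; ++-assoc; drop-all; ++-identityʳ)
open import Data.Product using (Σ; _×_; _,_; proj₁; proj₂)
open import Data.Sum using (_⊎_; inj₁; inj₂)
open import Data.Empty using (⊥; ⊥-elim)
open import Relation.Binary.PropositionalEquality

τ-++ : ∀ u v → τ (u ++ v) ≡ τ u ++ τ v
τ-++ [] v = refl
τ-++ (b ∷ u) v = trans (cong (τ₁ b ++_) (τ-++ u v)) (sym (++-assoc (τ₁ b) (τ u) (τ v)))

τ^-++ : ∀ n u v → τ^ n (u ++ v) ≡ τ^ n u ++ τ^ n v
τ^-++ zero u v = refl
τ^-++ (suc n) u v = trans (cong τ (τ^-++ n u v)) (τ-++ (τ^ n u) (τ^ n v))

τ^-suc : ∀ n w → τ^ (suc n) w ≡ τ^ n (τ w)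
τ^-suc zero w = refl
τ^-suc (suc n) w = cong τ (τ^-suc n w)

τ^-+ : ∀ m n w → τ^ m (τ^ n w) ≡ τ^ (m + n) w
τ^-+ zero n w = refl
τ^-+ (suc m) n w = cong τ (τ^-+ m n w)

τ^-[] : ∀ m → τ^ m [] ≡ []
τ^-[] zero = refl
τ^-[] (suc m) = cong τ (τ^-[] m)

A Z : ℕ → List Bool
A n = τ^ n (true ∷ [])
Z n = τ^ n (false ∷ [])

A-suc : ∀ n → A (suc n) ≡ A n ++ (Z n ++ A n)
A-suc n = trans (τ^-suc n (true ∷ [])) (trans (τ^-++ n (true ∷ []) (false ∷ true ∷ []))
  (cong (A n ++_) (τ^-++ n (false ∷ []) (true ∷ []))))

Z-suc : ∀ n → Z (suc n) ≡ A n
Z-suc n = τ^-suc n (false ∷ [])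

length-A : ∀ n → length (A n) ≡ fe n
length-A+length-Z : ∀ n → length (A n) + length (Z n) ≡ fo n
length-A zero = refl
length-A (suc n) = begin
  length (A (suc n)) ≡⟨ cong length (A-suc n) ⟩
  length (A n ++ (Z n ++ A n)) ≡⟨ length-++ (A n) ⟩
  length (A n) + length (Z n ++ A n) ≡⟨ cong (length (A n) +_) (length-++ (Z n)) ⟩
  length (A n) + (length (Z n) + length (A n)) ≡⟨ sym (+-assoc (length (A n)) (length (Z n)) (length (A n))) ⟩
  (length (A n) + length (Z n)) + length (A n) ≡⟨ cong₂ _+_ (length-A+length-Z n) (length-A n) ⟩
  fo n + fe n ≡⟨ +-comm (fo n) (fe n) ⟩
  fe (suc n) ∎
  where open ≡-Reasoning
length-A+length-Z zero = refl
length-A+length-Z (suc n) = begin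
  length (A (suc n)) + length (Z (suc n)) ≡⟨ cong₂ _+_ (length-A (suc n)) (cong length (Z-suc n)) ⟩
  fe (suc n) + length (A n) ≡⟨ cong (fe (suc n) +_) (length-A n) ⟩
  fe (suc n) + fe n ≡⟨ +-comm (fe (suc n)) (fe n) ⟩
  fo (suc n) ∎
  where open ≡-Reasoning

length-A++Z : ∀ n → length (A n ++ Z n) ≡ fo n
length-A++Z n = trans (length-++ (A n)) (length-A+length-Z n)

letter-++ˡ : ∀ u v i → i < length u → letter (u ++ v) i ≡ letter u i
letter-++ˡ (b ∷ u) v zero p = refl
letter-++ˡ (b ∷ u) v (suc i) (s≤s p) = letter-++ˡ u v i p

letter-++ʳ : ∀ u v i → letter (u ++ v) (length u + i) ≡ letter v i
letter-++ʳ [] v i = refl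
letter-++ʳ (b ∷ u) v i = letter-++ʳ u v i

sᵇ : ℕ → Bool
sᵇ j = letter (τ^ (suc j) (true ∷ [])) j

PrefixOfS : List Bool → Set
PrefixOfS w = ∀ i → i < length w → letter w i ≡ sᵇ i

PrefixOfS-++ˡ : ∀ u v → PrefixOfS (u ++ v) → PrefixOfS u
PrefixOfS-++ˡ u v P i p = trans (sym (letter-++ˡ u v i p)) (P i (≤-trans p (subst (length u ≤_) (sym (length-++ u)) (m≤m+n _ _))))

PrefixOfS-++ʳ : ∀ u v → PrefixOfS (u ++ v) → ∀ i → i < length v → letter v i ≡ sᵇ (length u + i)
PrefixOfS-++ʳ u v P i p = trans (sym (letter-++ʳ u v i)) (P (length u + i)
  (subst (length u + i <_) (sym (length-++ u)) (+-monoʳ-< (length u) p)))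

n<fe : ∀ n → n < fe n
n<fe zero = s≤s z≤n
n<fe (suc n) = ≤-trans (s≤s (n<fe n)) (subst (_≤ fe n + fo n) (+-comm (fe n) 1) (+-monoʳ-≤ (fe n) (fo≥1 n)))
  where
  fo≥1 : ∀ n → 1 ≤ fo n
  fo≥1 zero = s≤s z≤n
  fo≥1 (suc n) = ≤-trans (fo≥1' n) (m≤m+n (fe n) _)
    where
    fo≥1' : ∀ n → 1 ≤ fe n
    fo≥1' n = ≤-trans (s≤s z≤n) (n<fe n)

letter-A-+ : ∀ k n i → i < fe n → letter (A (k + n)) i ≡ letter (A n) i
letter-A-+ zero n i p = refl
letter-A-+ (suc k) n i p rewrite A-suc (k + n) =
  trans (letter-++ˡ (A (k + n)) _ i (subst (i <_) (sym (length-A (k + n))) (≤-trans p (fe-mono k n)))) (letter-A-+ k n i p)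
  where
  fe-mono : ∀ k n → fe n ≤ fe (k + n)
  fe-mono zero n = ≤-refl
  fe-mono (suc k) n = ≤-trans (fe-mono k n) (m≤m+n _ _)

A-prefixOfS : ∀ n → PrefixOfS (A n)
A-prefixOfS n i p = trans (sym (letter-A-+ (suc i) n i p')) (trans (cong (λ m → letter (A m) i) (+-comm (suc i) n))
  (letter-A-+ n (suc i) i (<-trans (n<1+n i) (n<fe (suc i)))))
  where p' = subst (i <_) (length-A n) p

sᵇ-shift-fo : ∀ n t → t < fe n → sᵇ (fo n + t) ≡ sᵇ t
sᵇ-shift-fo n t p = trans (cong (λ z → sᵇ (z + t)) (sym (length-A++Z n)))
  (trans (sym (PrefixOfS-++ʳ (A n ++ Z n) (A n) P t (subst (t <_) (sym (length-A n)) p))) (A-prefixOfS n t (subst (t <_) (sym (length-A n)) p)))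
  where
  P : PrefixOfS ((A n ++ Z n) ++ A n)
  P = subst PrefixOfS (trans (A-suc n) (sym (++-assoc (A n) (Z n) (A n)))) (A-prefixOfS (suc n))

sᵇ-shift-fe-suc : ∀ n t → t < fe n → sᵇ (fe (suc n) + t) ≡ sᵇ t
sᵇ-shift-fe-suc n t p = trans (cong (λ z → sᵇ (z + t)) (sym (length-A (suc n))))
  (trans (sym (PrefixOfS-++ʳ (A (suc n)) (Z (suc n) ++ A (suc n)) P t q2))
    (trans (letter-++ˡ (Z (suc n)) (A (suc n)) t q1) (trans (cong (λ w → letter w t) (Z-suc n)) (A-prefixOfS n t q0))))
  where
  P : PrefixOfS (A (suc n) ++ (Z (suc n) ++ A (suc n)))
  P = subst PrefixOfS (A-suc (suc n)) (A-prefixOfS (suc (suc n)))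
  q0 : t < length (A n)
  q0 = subst (t <_) (sym (length-A n)) p
  q1 : t < length (Z (suc n))
  q1 = subst (λ w → t < length w) (sym (Z-suc n)) q0
  q2 : t < length (Z (suc n) ++ A (suc n))
  q2 = subst (t <_) (sym (length-++ (Z (suc n)))) (≤-trans q1 (m≤m+n _ _))

prefix : ℕ → List Bool
prefix zero = []
prefix (suc q) = prefix q ++ (sᵇ q ∷ [])

length-prefix : ∀ q → length (prefix q) ≡ q
length-prefix zero = refl
length-prefix (suc q) = trans (length-++ (prefix q)) (trans (cong (_+ 1) (length-prefix q)) (+-comm q 1))

prefix-prefixOfS : ∀ q → PrefixOfS (prefix q)
prefix-prefixOfS zero i ()
prefix-prefixOfS (suc q) i p with m<1+n⇒m<n∨m≡n (subst (i <_) (length-prefix (suc q)) p)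
... | inj₁ i<q = trans (letter-++ˡ (prefix q) _ i (subst (i <_) (sym (length-prefix q)) i<q)) (prefix-prefixOfS q i (subst (i <_) (sym (length-prefix q)) i<q))
... | inj₂ refl = trans (cong (letter (prefix q ++ (sᵇ q ∷ []))) (sym (trans (+-identityʳ (length (prefix q))) (length-prefix q))))
   (letter-++ʳ (prefix q) (sᵇ q ∷ []) 0)

Agree : List Bool → List Bool → Set
Agree w v = ∀ i → i < length w → letter w i ≡ letter v i

agree-++-drop : ∀ w v → Agree w v → length w ≤ length v → w ++ drop (length w) v ≡ v
agree-++-drop [] v ag le = refl
agree-++-drop (b ∷ w) (c ∷ v) ag (s≤s le) =
  cong₂ _∷_ (ag 0 (s≤s z≤n)) (agree-++-drop w v (λ i p → ag (suc i) (s≤s p)) le)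

PrefixOfS-++-drop-A : ∀ w → PrefixOfS w → w ++ drop (length w) (A (length w)) ≡ A (length w)
PrefixOfS-++-drop-A w P = agree-++-drop w (A (length w)) (λ i p → trans (P i p) (sym (A-prefixOfS (length w) i
  (subst (i <_) (sym (length-A (length w))) (<-trans p (n<fe (length w))))))) 
  (subst (length w ≤_) (sym (length-A (length w))) (<⇒≤ (n<fe (length w))))

PrefixOfS-τ^ : ∀ m w → PrefixOfS w → PrefixOfS (τ^ m w)
PrefixOfS-τ^ m w P = PrefixOfS-++ˡ (τ^ m w) (τ^ m r) (subst PrefixOfS eq (A-prefixOfS (m + length w)))
  where
  r = drop (length w) (A (length w))
  eq : A (m + length w) ≡ τ^ m w ++ τ^ m r
  eq = trans (sym (τ^-+ m (length w) (true ∷ []))) (trans (cong (τ^ m) (sym (PrefixOfS-++-drop-A w P))) (τ^-++ m w r))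

blockStart : ℕ → ℕ → ℕ
blockStart m q = length (τ^ m (prefix q))

block : ℕ → Bool → List Bool
block m b = τ^ m (b ∷ [])

blockStart-suc : ∀ m q → blockStart m (suc q) ≡ blockStart m q + length (block m (sᵇ q))
blockStart-suc m q = trans (cong length (τ^-++ m (prefix q) (sᵇ q ∷ []))) (length-++ (τ^ m (prefix q)))

sᵇ-block : ∀ m q t → t < length (block m (sᵇ q)) → sᵇ (blockStart m q + t) ≡ letter (block m (sᵇ q)) t
sᵇ-block m q t p = sym (PrefixOfS-++ʳ (τ^ m (prefix q)) (block m (sᵇ q))
  (subst PrefixOfS (τ^-++ m (prefix q) (sᵇ q ∷ [])) (PrefixOfS-τ^ m (prefix (suc q)) (prefix-prefixOfS (suc q)))) t p)

<⊎≡+ : ∀ a t → t < a ⊎ Σ ℕ (λ t' → t ≡ a + t')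
<⊎≡+ zero t = inj₂ (t , refl)
<⊎≡+ (suc a) zero = inj₁ (s≤s z≤n)
<⊎≡+ (suc a) (suc t) with <⊎≡+ a t
... | inj₁ p = inj₁ (s≤s p)
... | inj₂ (t' , e) = inj₂ (t' , cong suc e)

fo/2 : ℕ → ℕ
fo/2 zero = 1
fo/2 (suc k) = fe k + fo/2 k

fo≡fo/2+fo/2 : ∀ k → fo k ≡ fo/2 k + fo/2 k
fo≡fo/2+fo/2 zero = refl
fo≡fo/2+fo/2 (suc k) = trans (cong (λ z → fe k + (fe k + z)) (fo≡fo/2+fo/2 k)) (lem (fe k) (fo/2 k))
  where
  lem : ∀ a b → a + (a + (b + b)) ≡ (a + b) + (a + b)
  lem = solve-∀

1≤fo/2 : ∀ k → 1 ≤ fo/2 k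
1≤fo/2 zero = s≤s z≤n
1≤fo/2 (suc k) = ≤-trans (1≤fo/2 k) (m≤n+m (fo/2 k) (fe k))

fo/2<fo : ∀ k → fo/2 k < fo k
fo/2<fo k = subst (fo/2 k <_) (sym (fo≡fo/2+fo/2 k)) (subst (_≤ fo/2 k + fo/2 k) (+-comm (fo/2 k) 1) (+-monoʳ-≤ (fo/2 k) (1≤fo/2 k)))

fo/2<fe : ∀ k → fo/2 (suc k) < fe (suc k)
fo/2<fe k = +-monoʳ-< (fe k) (fo/2<fo k)

fo/2≤fe : ∀ k → fo/2 k ≤ fe k
fo/2≤fe zero = ≤-refl
fo/2≤fe (suc k) = <⇒≤ (fo/2<fe k)

fe/2 : ℕ → ℕ
fe/2 zero = 0
fe/2 (suc k) = fe/2 k + fo/2 k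

fe≡1+fe/2+fe/2 : ∀ k → fe k ≡ suc (fe/2 k + fe/2 k)
fe≡1+fe/2+fe/2 zero = refl
fe≡1+fe/2+fe/2 (suc k) = trans (cong₂ _+_ (fe≡1+fe/2+fe/2 k) (fo≡fo/2+fo/2 k)) (lem (fe/2 k) (fo/2 k))
  where
  lem : ∀ g h → suc (g + g) + (h + h) ≡ suc ((g + h) + (g + h))
  lem = solve-∀

sᵇ-shift-fe-low : ∀ n t → suc t < fo/2 n → sᵇ (fe n + t) ≡ sᵇ t
sᵇ-shift-fe-low zero t (s≤s ())
sᵇ-shift-fe-low (suc m) t p with <⊎≡+ (fe m) t
... | inj₁ q = sᵇ-shift-fe-suc m t q
... | inj₂ (t' , refl) = trans (cong sᵇ (lem (fe m) (fo m) t')) (trans (sᵇ-shift-fo (suc m) t' q1) (sym (sᵇ-shift-fe-low m t' q2)))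
  where
  lem : ∀ a b c → (a + b) + (a + c) ≡ (a + (a + b)) + c
  lem = solve-∀
  q2 : suc t' < fo/2 m
  q2 = +-cancelˡ-< (fe m) (suc t') (fo/2 m) (subst (_< fe m + fo/2 m) (sym (+-suc (fe m) t')) p)
  q1 : t' < fe (suc m)
  q1 = ≤-trans (≤-trans (n≤1+n _) q2) (≤-trans (<⇒≤ (fo/2<fo m)) (m≤n+m (fo m) (fe m)))

sᵇ-shift-fe-high : ∀ n u → fo/2 n < u → u < fo n → sᵇ (fe n + u) ≡ sᵇ u
sᵇ-shift-fe-high zero u p q = ⊥-elim (lem p q)
  where
  lem : ∀ {u} → 1 < u → u < 2 → ⊥
  lem (s≤s (s≤s z≤n)) (s≤s (s≤s ()))
sᵇ-shift-fe-high (suc m) u p q with <⊎≡+ (fe (suc m)) u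
... | inj₁ r with <⊎≡+ (fe m) u
...   | inj₁ r' = ⊥-elim (<-irrefl refl (<-trans r' (≤-<-trans (m≤m+n (fe m) (fo/2 m)) p)))
...   | inj₂ (w , refl) = trans (cong sᵇ (lem (fe m) (fo m) w)) (trans (sᵇ-shift-fo (suc m) w w<) (sym (sᵇ-shift-fe-high m w hw w<fo)))
  where
  lem : ∀ a b c → (a + b) + (a + c) ≡ (a + (a + b)) + c
  lem = solve-∀
  hw : fo/2 m < w
  hw = +-cancelˡ-< (fe m) (fo/2 m) w p
  w<fo : w < fo m
  w<fo = +-cancelˡ-< (fe m) w (fo m) r
  w< : w < fe (suc m)
  w< = ≤-trans w<fo (m≤n+m (fo m) (fe m))
sᵇ-shift-fe-high (suc m) u p q | inj₂ (t , refl) =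
  trans (cong sᵇ (lem (fe m) (fo m) t)) (trans (sᵇ-shift-fo (suc m) (fo m + t) q1) (trans (sᵇ-shift-fo m t t<) (sym (sᵇ-shift-fe-suc m t t<))))
  where
  lem : ∀ a b c → (a + b) + ((a + b) + c) ≡ (a + (a + b)) + (b + c)
  lem = solve-∀
  t< : t < fe m
  t< = +-cancelˡ-< (fe m + fo m) t (fe m) (subst (fe m + fo m + t <_) (+-comm (fe m) (fe m + fo m)) q)
  q1 : fo m + t < fe (suc m)
  q1 = subst (fo m + t <_) (+-comm (fo m) (fe m)) (+-monoʳ-< (fo m) t<)

sᵇ-block-true : ∀ m q t → sᵇ q ≡ true → t < fe m → sᵇ (blockStart m q + t) ≡ sᵇ t
sᵇ-block-true m q t e p = trans (sᵇ-block m q t p') (trans (cong (λ b → letter (block m b) t) e) (A-prefixOfS m t (subst (t <_) (sym (length-A m)) p)))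
  where
  p' : t < length (block m (sᵇ q))
  p' = subst (λ b → t < length (block m b)) (sym e) (subst (t <_) (sym (length-A m)) p)

block-suc-prefix : ∀ m b t → t < fe m → t < length (block (suc m) b) × letter (block (suc m) b) t ≡ sᵇ t
block-suc-prefix m true t p = p1 , A-prefixOfS (suc m) t p1
  where p1 = subst (t <_) (sym (length-A (suc m))) (≤-trans p (m≤m+n (fe m) (fo m)))
block-suc-prefix m false t p = subst (λ w → t < length w) (sym (Z-suc m)) p0 ,
  trans (cong (λ w → letter w t) (Z-suc m)) (A-prefixOfS m t p0)
  where p0 = subst (t <_) (sym (length-A m)) p

sᵇ-next-block : ∀ m q t → t < fe m → sᵇ (blockStart (suc m) (suc q) + t) ≡ sᵇ t
sᵇ-next-block m q t p = trans (sᵇ-block (suc m) (suc q) t (proj₁ (block-suc-prefix m (sᵇ (suc q)) t p))) (proj₂ (block-suc-prefix m (sᵇ (suc q)) t p))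

block-ends-with-A′ : ∀ m q b → sᵇ q ≡ b → Σ ℕ (λ X → blockStart (suc m) (suc q) ≡ X + fe m × (∀ t → t < fe m → sᵇ (X + t) ≡ sᵇ t))
block-ends-with-A′ m q false eq = blockStart (suc m) q , e1 , λ t p → trans (sᵇ-block (suc m) q t (p1 t p))
        (trans (cong (λ b → letter (block (suc m) b) t) eq) (trans (cong (λ w → letter w t) (Z-suc m)) (A-prefixOfS m t (subst (t <_) (sym (length-A m)) p))))
  where
  e0 : length (block (suc m) (sᵇ q)) ≡ fe m
  e0 = trans (cong (λ b → length (block (suc m) b)) eq) (trans (cong length (Z-suc m)) (length-A m))
  e1 : blockStart (suc m) (suc q) ≡ blockStart (suc m) q + fe m
  e1 = trans (blockStart-suc (suc m) q) (cong (blockStart (suc m) q +_) e0)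
  p1 : ∀ t → t < fe m → t < length (block (suc m) (sᵇ q))
  p1 t p = subst (t <_) (sym e0) p
block-ends-with-A′ m q true eq = blockStart (suc m) q + fo m , e1 , λ t p → trans (cong sᵇ (+-assoc (blockStart (suc m) q) (fo m) t))
        (trans (sᵇ-block-true (suc m) q (fo m + t) eq (subst (fo m + t <_) (+-comm (fo m) (fe m)) (+-monoʳ-< (fo m) p))) (sᵇ-shift-fo m t p))
  where
  e0 : length (block (suc m) (sᵇ q)) ≡ fe m + fo m
  e0 = trans (cong (λ b → length (block (suc m) b)) eq) (length-A (suc m))
  e1 : blockStart (suc m) (suc q) ≡ blockStart (suc m) q + fo m + fe m
  e1 = trans (blockStart-suc (suc m) q) (trans (cong (blockStart (suc m) q +_) (trans e0 (+-comm (fe m) (fo m)))) (sym (+-assoc (blockStart (suc m) q) (fo m) (fe m))))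

block-ends-with-A : ∀ m q → Σ ℕ (λ X → blockStart (suc m) (suc q) ≡ X + fe m × (∀ t → t < fe m → sᵇ (X + t) ≡ sᵇ t))
block-ends-with-A m q = block-ends-with-A′ m q (sᵇ q) refl

blockStart-zero : ∀ m → blockStart m 0 ≡ 0
blockStart-zero m = cong length (τ^-[] m)

blockStart-suc-true : ∀ m q → sᵇ q ≡ true → blockStart m (suc q) ≡ blockStart m q + fe m
blockStart-suc-true m q e = trans (blockStart-suc m q) (cong (blockStart m q +_) (trans (cong (λ b → length (block m b)) e) (length-A m)))

block-ends-with-A-nonempty : ∀ k q → 1 ≤ blockStart (suc k) q →
  Σ ℕ (λ X → blockStart (suc k) q ≡ X + fe k × (∀ t → t < fe k → sᵇ (X + t) ≡ sᵇ t))
block-ends-with-A-nonempty k zero    p = ⊥-elim (<-irrefl refl (subst (1 ≤_) (blockStart-zero (suc k)) p))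
block-ends-with-A-nonempty k (suc q) p = block-ends-with-A k q

fFrom-even : ∀ (e o : ℕ → ℕ) j → fFrom e o (2 * j) ≡ e j
fFrom-even e o zero = refl
fFrom-even e o (suc j) = trans (cong (fFrom e o) (*-suc 2 j)) (fFrom-even (λ i → e (suc i)) (λ i → o (suc i)) j)

fFrom-odd : ∀ (e o : ℕ → ℕ) j → fFrom e o (suc (2 * j)) ≡ o j
fFrom-odd e o zero = refl
fFrom-odd e o (suc j) = trans (cong (λ z → fFrom e o (suc z)) (*-suc 2 j)) (fFrom-odd (λ i → e (suc i)) (λ i → o (suc i)) j)

f-even : ∀ j → f (2 * j) ≡ fe j
f-even = fFrom-even fe fo
f-odd : ∀ j → f (suc (2 * j)) ≡ fo j
f-odd = fFrom-odd fe fo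
f-even-suc : ∀ j → f (suc (suc (2 * j))) ≡ fe (suc j)
f-even-suc = fFrom-even (λ i → fe (suc i)) (λ i → fo (suc i))
f-odd-suc : ∀ j → f (suc (suc (suc (2 * j)))) ≡ fo (suc j)
f-odd-suc = fFrom-odd (λ i → fe (suc i)) (λ i → fo (suc i))

f-2k+1 : ∀ k → f (2 * k + 1) ≡ fo k
f-2k+1 k = trans (cong f (+-comm (2 * k) 1)) (f-odd k)

f-2k+2 : ∀ k → f (2 * k + 2) ≡ fe (suc k)
f-2k+2 k = trans (cong f (+-comm (2 * k) 2)) (f-even-suc k)

f-2k+3 : ∀ k → f (2 * k + 3) ≡ fo (suc k)
f-2k+3 k = trans (cong f (+-comm (2 * k) 3)) (f-odd-suc k)

data Parity : ℕ → Set where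
  isZero : Parity 0
  isOdd : ∀ j → Parity (suc (2 * j))
  isEven : ∀ j → Parity (suc (suc (2 * j)))

parity : ∀ n → Parity n
parity zero = isZero
parity (suc n) with parity n
... | isZero = isOdd 0
... | isOdd j = isEven j
... | isEven j = subst Parity (cong suc (*-suc 2 j)) (isOdd (suc j))

bool-cases : ∀ d n → digit d n ≡ false ⊎ digit d n ≡ true
bool-cases d n with digit d n
... | false = inj₁ refl
... | true = inj₂ refl

partialVal-false : ∀ d n → digit d n ≡ false → partialVal (suc n) d ≡ partialVal n d
partialVal-false d n e = trans (cong (λ b → partialVal n d + bit b * f n) e) (+-identityʳ _)

partialVal-true : ∀ d n → digit d n ≡ true → partialVal (suc n) d ≡ partialVal n d + f n
partialVal-true d n e = trans (cong (λ b → partialVal n d + bit b * f n) e) (cong (partialVal n d +_) (+-identityʳ (f n)))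

digit-before-one : ∀ {d} → Admissible d → ∀ i → digit d (suc i) ≡ true → digit d i ≡ false
digit-before-one {d} A i e with bool-cases d i
... | inj₁ x = x
... | inj₂ x = ⊥-elim (proj₁ A i (x , e))

digit-after-one : ∀ {d} → Admissible d → ∀ i → digit d i ≡ true → digit d (suc i) ≡ false
digit-after-one {d} A i e with bool-cases d (suc i)
... | inj₁ x = x
... | inj₂ x = ⊥-elim (proj₁ A i (e , x))

digit-two-before-one : ∀ {d} → Admissible d → ∀ i → Even i → digit d (suc (suc i)) ≡ true → digit d i ≡ false
digit-two-before-one {d} A i ev e with bool-cases d i
... | inj₁ x = x
... | inj₂ x = ⊥-elim (proj₂ A i ev (x , e))

Even-2* : ∀ j → Even (2 * j)
Even-2* zero = even0
Even-2* (suc j) = subst Even (sym (*-suc 2 j)) (even+2 (Even-2* j))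

partialVal-bounds : ∀ {d} → Admissible d → ∀ j → partialVal (2 * j) d < fe j × partialVal (suc (2 * j)) d < fo j
partialVal-bounds {d} A zero with bool-cases d 0
... | inj₁ x = s≤s z≤n , subst (_< 2) (sym (partialVal-false d 0 x)) (s≤s z≤n)
... | inj₂ x = s≤s z≤n , subst (_< 2) (sym (partialVal-true d 0 x)) (s≤s (s≤s z≤n))
partialVal-bounds {d} A (suc j) = subst (λ z → partialVal z d < fe (suc j)) (sym (*-suc 2 j)) b1 ,
                       subst (λ z → partialVal (suc z) d < fo (suc j)) (sym (*-suc 2 j)) b2
  where
  ih = partialVal-bounds {d} A j
  b1 : partialVal (suc (suc (2 * j))) d < fe (suc j)
  b1 with bool-cases d (suc (2 * j))
  ... | inj₁ x = subst (_< fe (suc j)) (sym (partialVal-false d _ x)) (≤-trans (proj₂ ih) (m≤n+m (fo j) (fe j)))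
  ... | inj₂ x = subst (_< fe (suc j)) (sym (trans (partialVal-true d _ x) (cong₂ _+_ (partialVal-false d _ (digit-before-one {d} A _ x)) (f-odd j))))
                   (+-monoˡ-< (fo j) (proj₁ ih))
  b2 : partialVal (suc (suc (suc (2 * j)))) d < fo (suc j)
  b2 with bool-cases d (suc (suc (2 * j)))
  ... | inj₁ x = subst (_< fo (suc j)) (sym (partialVal-false d _ x)) (≤-trans b1 (m≤n+m (fe (suc j)) (fe j)))
  ... | inj₂ x = subst (_< fo (suc j)) (sym (trans (partialVal-true d _ x)
                    (cong₂ _+_ (trans (partialVal-false d _ (digit-before-one {d} A _ x))
                                      (partialVal-false d _ (digit-two-before-one {d} A _ (Even-2* j) x)))
                               (f-even-suc j))))
                   (+-monoˡ-< (fe (suc j)) (proj₁ ih))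

sᵇ-shift-by-digit : ∀ {d} → Admissible d → ∀ n → digit d (suc n) ≡ true → ∀ i → i ≤ partialVal (suc n) d → sᵇ (f (suc n) + i) ≡ sᵇ i
sᵇ-shift-by-digit {d} A n e i le = go (parity (suc n)) refl e le
  where
  go : ∀ {m} → Parity m → m ≡ suc n → digit d m ≡ true → i ≤ partialVal m d → sᵇ (f m + i) ≡ sᵇ i
  go isZero () e le
  go (isOdd j) _ e le = trans (cong (λ z → sᵇ (z + i)) (f-odd j))
    (sᵇ-shift-fo j i (≤-<-trans le (subst (_< fe j) (sym (partialVal-false d _ (digit-before-one {d} A _ e))) (proj₁ (partialVal-bounds {d} A j)))))
  go (isEven j) _ e le = trans (cong (λ z → sᵇ (z + i)) (f-even-suc j))
    (sᵇ-shift-fe-suc j i (≤-<-trans le (subst (_< fe j) (sym (trans (partialVal-false d _ (digit-before-one {d} A _ e))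
                                                                    (partialVal-false d _ (digit-two-before-one {d} A _ (Even-2* j) e))))
                                                 (proj₁ (partialVal-bounds {d} A j)))))

prefix-+ : ∀ a b → (∀ i → i < b → sᵇ (a + i) ≡ sᵇ i) → prefix (a + b) ≡ prefix a ++ prefix b
prefix-+ a zero h = trans (cong prefix (+-identityʳ a)) (sym (++-identityʳ (prefix a)))
prefix-+ a (suc b) h = begin
  prefix (a + suc b) ≡⟨ cong prefix (+-suc a b) ⟩
  prefix (a + b) ++ (sᵇ (a + b) ∷ []) ≡⟨ cong₂ (λ u v → u ++ (v ∷ [])) (prefix-+ a b (λ i p → h i (≤-trans p (n≤1+n b)))) (h b ≤-refl) ⟩
  (prefix a ++ prefix b) ++ (sᵇ b ∷ []) ≡⟨ ++-assoc (prefix a) (prefix b) _ ⟩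
  prefix a ++ prefix (suc b) ∎
  where open ≡-Reasoning

PrefixOfS-unique : ∀ w v → PrefixOfS w → PrefixOfS v → length w ≡ length v → w ≡ v
PrefixOfS-unique w v P Q e = trans (sym (++-identityʳ w)) (trans (cong (w ++_) (sym (drop-all (length w) v (≤-reflexive (sym e)))))
  (agree-++-drop w v (λ i p → trans (P i p) (sym (Q i (subst (i <_) e p)))) (≤-reflexive e)))

A++Z-prefixOfS : ∀ j → PrefixOfS (A j ++ Z j)
A++Z-prefixOfS j = PrefixOfS-++ˡ (A j ++ Z j) (A j) (subst PrefixOfS (trans (A-suc j) (sym (++-assoc (A j) (Z j) (A j)))) (A-prefixOfS (suc j)))

length-τ^-prefix-f : ∀ m n → length (τ^ m (prefix (f n))) ≡ f (2 * m + n)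
length-τ^-prefix-f m n = go (parity n)
  where
  go : ∀ {n} → Parity n → length (τ^ m (prefix (f n))) ≡ f (2 * m + n)
  go isZero = trans (length-A m) (sym (trans (cong f (+-identityʳ (2 * m))) (f-even m)))
  go (isOdd j) = begin
    length (τ^ m (prefix (f (suc (2 * j))))) ≡⟨ cong (λ z → length (τ^ m (prefix z))) (f-odd j) ⟩
    length (τ^ m (prefix (fo j)))
      ≡⟨ cong (λ w → length (τ^ m w)) (PrefixOfS-unique _ _ (prefix-prefixOfS (fo j)) (A++Z-prefixOfS j)
                                                         (trans (length-prefix (fo j)) (sym (length-A++Z j)))) ⟩
    length (τ^ m (A j ++ Z j)) ≡⟨ cong length (τ^-++ m (A j) (Z j)) ⟩
    length (τ^ m (A j) ++ τ^ m (Z j)) ≡⟨ cong₂ (λ u v → length (u ++ v)) (τ^-+ m j _) (τ^-+ m j _) ⟩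
    length (A (m + j) ++ Z (m + j)) ≡⟨ length-A++Z (m + j) ⟩
    fo (m + j) ≡⟨ sym (f-odd (m + j)) ⟩
    f (suc (2 * (m + j))) ≡⟨ cong f (lem m j) ⟩
    f (2 * m + suc (2 * j)) ∎
    where
    open ≡-Reasoning
    lem : ∀ m j → suc (2 * (m + j)) ≡ 2 * m + suc (2 * j)
    lem = solve-∀
  go (isEven j) = begin
    length (τ^ m (prefix (f (suc (suc (2 * j)))))) ≡⟨ cong (λ z → length (τ^ m (prefix z))) (f-even-suc j) ⟩
    length (τ^ m (prefix (fe (suc j))))
      ≡⟨ cong (λ w → length (τ^ m w)) (PrefixOfS-unique _ _ (prefix-prefixOfS (fe (suc j))) (A-prefixOfS (suc j))
                                                         (trans (length-prefix _) (sym (length-A (suc j))))) ⟩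
    length (τ^ m (A (suc j))) ≡⟨ cong length (τ^-+ m (suc j) _) ⟩
    length (A (m + suc j)) ≡⟨ length-A (m + suc j) ⟩
    fe (m + suc j) ≡⟨ sym (f-even (m + suc j)) ⟩
    f (2 * (m + suc j)) ≡⟨ cong f (lem m j) ⟩
    f (2 * m + suc (suc (2 * j))) ∎
    where
    open ≡-Reasoning
    lem : ∀ m j → 2 * (m + suc j) ≡ 2 * m + suc (suc (2 * j))
    lem = solve-∀

shiftedValue : ℕ → ℕ → List Bool → ℕ
shiftedValue m zero e = 0
shiftedValue m (suc n) e = shiftedValue m n e + bit (digit e n) * f (2 * m + n)

blockStart-+ : ∀ m a b → (∀ i → i < b → sᵇ (a + i) ≡ sᵇ i) → blockStart m (a + b) ≡ length (τ^ m (prefix a)) + blockStart m b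
blockStart-+ m a b h = trans (cong (λ w → length (τ^ m w)) (prefix-+ a b h)) (trans (cong length (τ^-++ m (prefix a) (prefix b))) (length-++ (τ^ m (prefix a))))

blockStart-partialVal : ∀ {e} → Admissible e → ∀ n m → blockStart m (partialVal n e) ≡ shiftedValue m n e
blockStart-partialVal {e} A zero m = cong length (τ^-[] m)
blockStart-partialVal {e} A (suc n) m with bool-cases e n
... | inj₁ x = trans (cong (blockStart m) (partialVal-false e n x)) (trans (blockStart-partialVal {e} A n m)
                 (sym (trans (cong (λ b → shiftedValue m n e + bit b * f (2 * m + n)) x) (+-identityʳ _))))
... | inj₂ x = begin
  blockStart m (partialVal (suc n) e) ≡⟨ cong (blockStart m) (trans (partialVal-true e n x) (+-comm (partialVal n e) (f n))) ⟩
  blockStart m (f n + partialVal n e) ≡⟨ blockStart-+ m (f n) (partialVal n e) (pk n x) ⟩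
  length (τ^ m (prefix (f n))) + blockStart m (partialVal n e) ≡⟨ cong₂ _+_ (length-τ^-prefix-f m n) (blockStart-partialVal {e} A n m) ⟩
  f (2 * m + n) + shiftedValue m n e ≡⟨ +-comm _ (shiftedValue m n e) ⟩
  shiftedValue m n e + f (2 * m + n) ≡⟨ sym (trans (cong (λ b → shiftedValue m n e + bit b * f (2 * m + n)) x) (cong (shiftedValue m n e +_) (+-identityʳ _))) ⟩
  shiftedValue m (suc n) e ∎
  where
  open ≡-Reasoning
  pk : ∀ n → digit e n ≡ true → ∀ i → i < partialVal n e → sᵇ (f n + i) ≡ sᵇ i
  pk zero x i ()
  pk (suc n) x i p = sᵇ-shift-by-digit {e} A n x i (<⇒≤ p)

sᵇ-partialVal : ∀ {e} → Admissible e → ∀ n → sᵇ (partialVal (suc n) e) ≡ not (digit e 0)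
sᵇ-partialVal {e} A zero with bool-cases e 0
... | inj₁ x = trans (cong sᵇ (partialVal-false e 0 x)) (cong not (sym x))
... | inj₂ x = trans (cong sᵇ (partialVal-true e 0 x)) (cong not (sym x))
sᵇ-partialVal {e} A (suc n) with bool-cases e (suc n)
... | inj₁ x = trans (cong sᵇ (partialVal-false e (suc n) x)) (sᵇ-partialVal {e} A n)
... | inj₂ x = trans (cong sᵇ (trans (partialVal-true e (suc n) x) (+-comm _ (f (suc n))))) (trans (sᵇ-shift-by-digit {e} A n x _ ≤-refl) (sᵇ-partialVal {e} A n))

letter-beyond : ∀ w j → letter w (len w + j) ≡ false
letter-beyond [] j = refl
letter-beyond (b ∷ w) j = letter-beyond w j

partialVal-beyond : ∀ w j → partialVal (len w + j) w ≡ value w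
partialVal-beyond w zero = cong (λ z → partialVal z w) (+-identityʳ (len w))
partialVal-beyond w (suc j) = trans (cong (λ z → partialVal z w) (+-suc (len w) j)) (trans (partialVal-false w _ (letter-beyond w j)) (partialVal-beyond w j))

letter-drop : ∀ c d i → letter (drop c d) i ≡ letter d (c + i)
letter-drop zero d i = refl
letter-drop (suc c) [] i = refl
letter-drop (suc c) (b ∷ d) i = letter-drop c d i

len-drop : ∀ c d → len (drop c d) ≤ len d
len-drop zero d = ≤-refl
len-drop (suc c) [] = z≤n
len-drop (suc c) (b ∷ d) = ≤-trans (len-drop c d) (n≤1+n _)

Even-2*+ : ∀ m i → Even i → Even (2 * m + i)
Even-2*+ zero i ev = ev
Even-2*+ (suc m) i ev = subst (λ z → Even (z + i)) (sym (*-suc 2 m)) (even+2 (Even-2*+ m i ev))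

Admissible-drop : ∀ {d} → Admissible d → ∀ m → Admissible (drop (2 * m) d)
Admissible-drop {d} A m = (λ i p → proj₁ A (2 * m + i)
     (trans (sym (letter-drop (2 * m) d i)) (proj₁ p) , trans (cong (letter d) (sym (+-suc (2 * m) i))) (trans (sym (letter-drop (2 * m) d (suc i))) (proj₂ p))))
  , (λ i ev p → proj₂ A (2 * m + i) (Even-2*+ m i ev)
     (trans (sym (letter-drop (2 * m) d i)) (proj₁ p) ,
      trans (cong (letter d) (sym (trans (+-suc (2 * m) (suc i)) (cong suc (+-suc (2 * m) i))))) (trans (sym (letter-drop (2 * m) d (suc (suc i)))) (proj₂ p))))

partialVal-split : ∀ m N d → partialVal (2 * m + N) d ≡ partialVal (2 * m) d + shiftedValue m N (drop (2 * m) d)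
partialVal-split m zero d = trans (cong (λ z → partialVal z d) (+-identityʳ (2 * m))) (sym (+-identityʳ _))
partialVal-split m (suc N) d = begin
  partialVal (2 * m + suc N) d ≡⟨ cong (λ z → partialVal z d) (+-suc (2 * m) N) ⟩
  partialVal (2 * m + N) d + bit (digit d (2 * m + N)) * f (2 * m + N)
    ≡⟨ cong₂ (λ u b → u + bit b * f (2 * m + N)) (partialVal-split m N d) (sym (letter-drop (2 * m) d N)) ⟩
  partialVal (2 * m) d + shiftedValue m N e + bit (digit e N) * f (2 * m + N) ≡⟨ +-assoc (partialVal (2 * m) d) _ _ ⟩
  partialVal (2 * m) d + shiftedValue m (suc N) e ∎
  where
  open ≡-Reasoning
  e = drop (2 * m) d

value-split : ∀ {d} → Admissible d → ∀ m →
  value d ≡ partialVal (2 * m) d + blockStart m (value (drop (2 * m) d)) ×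
  sᵇ (value (drop (2 * m) d)) ≡ not (digit d (2 * m))
value-split {d} A m = e1 , e2
  where
  e = drop (2 * m) d
  N = suc (len d)
  Ae = Admissible-drop {d} A m
  j' = proj₁ (m≤n⇒∃[o]m+o≡n (≤-trans (len-drop (2 * m) d) (n≤1+n (len d))))
  ej : len e + j' ≡ N
  ej = proj₂ (m≤n⇒∃[o]m+o≡n (≤-trans (len-drop (2 * m) d) (n≤1+n (len d))))
  ve : partialVal N e ≡ value e
  ve = trans (cong (λ z → partialVal z e) (sym ej)) (partialVal-beyond e j')
  lem : ∀ a b → a + suc (2 * b) ≡ 2 * b + suc a
  lem = solve-∀
  e1 : value d ≡ partialVal (2 * m) d + blockStart m (value e)
  e1 = begin
    value d ≡⟨ sym (partialVal-beyond d (suc (2 * m))) ⟩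
    partialVal (len d + suc (2 * m)) d ≡⟨ cong (λ z → partialVal z d) (lem (len d) m) ⟩
    partialVal (2 * m + N) d ≡⟨ partialVal-split m N d ⟩
    partialVal (2 * m) d + shiftedValue m N e ≡⟨ cong (partialVal (2 * m) d +_) (sym (blockStart-partialVal {e} Ae N m)) ⟩
    partialVal (2 * m) d + blockStart m (partialVal N e) ≡⟨ cong (λ z → partialVal (2 * m) d + blockStart m z) ve ⟩
    partialVal (2 * m) d + blockStart m (value e) ∎
    where open ≡-Reasoning
  e2 : sᵇ (value e) ≡ not (digit d (2 * m))
  e2 = trans (cong sᵇ (sym ve)) (trans (sᵇ-partialVal {e} Ae (len d)) (cong not (trans (letter-drop (2 * m) d 0) (cong (letter d) (+-identityʳ (2 * m))))))

value-in-block : ∀ m d x V → Admissible d → value d ≡ x → partialVal (suc (2 * m)) d ≡ V → V < fe m →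
  digit d (2 * m) ≡ false × x ≡ blockStart m (value (drop (2 * m) d)) + V × sᵇ (value (drop (2 * m) d)) ≡ true
value-in-block m d x V A ev ep lt with bool-cases d (2 * m)
... | inj₂ t = ⊥-elim (<-irrefl refl (<-≤-trans lt (subst (fe m ≤_) ep
        (subst (fe m ≤_) (sym (partialVal-true d (2 * m) t)) (subst (_≤ partialVal (2 * m) d + f (2 * m)) (f-even m) (m≤n+m _ _))))))
... | inj₁ t = t ,
      trans (sym ev) (trans (proj₁ S) (trans (cong (_+ _) (trans (sym (partialVal-false d _ t)) ep)) (+-comm V _))) ,
      trans (proj₂ S) (cong not t)
  where S = value-split {d} A m

2k+3≡1+2[1+k] : ∀ k → 2 * k + 3 ≡ suc (2 * suc k)
2k+3≡1+2[1+k] = solve-∀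

⌊f2k+3/2⌋ : ∀ k → ⌊ f (2 * k + 3) /2⌋ ≡ fo/2 (suc k)
⌊f2k+3/2⌋ k = trans (cong ⌊_/2⌋ (trans (f-2k+3 k) (fo≡fo/2+fo/2 (suc k)))) (sym (n≡⌊n+n/2⌋ _))

⌊f2k+1/2⌋ : ∀ k → ⌊ f (2 * k + 1) /2⌋ ≡ fo/2 k
⌊f2k+1/2⌋ k = trans (cong ⌊_/2⌋ (trans (f-2k+1 k) (fo≡fo/2+fo/2 k))) (sym (n≡⌊n+n/2⌋ _))

E'-in-block : ∀ k x → E' k x → Σ ℕ (λ q → x ≡ blockStart (suc k) q + fo/2 (suc k) × sᵇ q ≡ true)
E'-in-block k x (d , (A , ev) , ep) = value (drop (2 * suc k) d) , proj₂ in-block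
  where
  in-block = value-in-block (suc k) d x (fo/2 (suc k)) A ev
    (trans (cong (λ z → partialVal z d) (sym (2k+3≡1+2[1+k] k))) (trans ep (⌊f2k+3/2⌋ k))) (fo/2<fe k)

F''-in-block : ∀ k y → F'' k y → Σ ℕ (λ q → y ≡ blockStart (suc k) q + fo/2 k × sᵇ q ≡ true × sᵇ (suc q) ≡ true)
F''-in-block k y ((d , (A , ev) , ep) , nF') = q , proj₁ (proj₂ r) , proj₂ (proj₂ r) , nextT
  where
  m = suc k
  ep' : partialVal (suc (2 * m)) d ≡ fo/2 k
  ep' = trans (cong (λ z → partialVal z d) (sym (2k+3≡1+2[1+k] k))) (trans ep (⌊f2k+1/2⌋ k))
  r = value-in-block m d y (fo/2 k) A ev ep' (≤-<-trans (fo/2≤fe k) (m<m+n (fe k) (≤-<-trans z≤n (fo/2<fo k))))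
  e = drop (2 * m) d
  q = value e
  Ae = Admissible-drop {d} A m
  e0 : digit e 0 ≡ false
  e0 = trans (letter-drop (2 * m) d 0) (trans (cong (letter d) (+-identityʳ _)) (proj₁ r))
  e12 : digit e 1 ≡ true ⊎ digit e 2 ≡ true
  e12 with bool-cases e 1 | bool-cases e 2
  ... | inj₂ x | _ = inj₁ x
  ... | inj₁ _ | inj₂ x = inj₂ x
  ... | inj₁ x1 | inj₁ x2 = ⊥-elim (nF' (d , (A , ev) , ep5))
    where
    j1 : 2 * m + 1 ≡ 2 * k + 3
    j1 = lemma k
      where lemma : ∀ k → 2 * suc k + 1 ≡ 2 * k + 3
            lemma = solve-∀
    j2 : 2 * m + 2 ≡ suc (2 * k + 3)
    j2 = trans (+-suc (2 * m) 1) (cong suc j1)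
    x1' : digit d (2 * k + 3) ≡ false
    x1' = trans (cong (letter d) (sym j1)) (trans (sym (letter-drop (2 * m) d 1)) x1)
    x2' : digit d (suc (2 * k + 3)) ≡ false
    x2' = trans (cong (letter d) (sym j2)) (trans (sym (letter-drop (2 * m) d 2)) x2)
    ep5 : partialVal (2 * suc k + 3) d ≡ ⌊ f (2 * k + 1) /2⌋
    ep5 = trans (cong (λ z → partialVal z d) (trans (+-suc (2 * m) 2) (cong suc j2))) (trans (partialVal-false d _ x2') (trans (partialVal-false d _ x1') ep))
  S1 = value-split {e} Ae 1
  e' = drop 2 e
  q' = value e'
  fin : suc q ≡ blockStart 1 (suc q') + 0 → sᵇ (suc q) ≡ true
  fin eq = trans (cong sᵇ eq) (sᵇ-next-block 0 q' 0 (s≤s z≤n))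
  nextT : sᵇ (suc q) ≡ true
  nextT with e12
  ... | inj₁ x = fin (trans (cong suc (proj₁ S1)) (trans (cong (λ z → suc (z + blockStart 1 q')) p2)
          (trans (+-comm 3 (blockStart 1 q')) (sym (trans (+-identityʳ _) (trans (blockStart-suc 1 q') (cong (λ b → blockStart 1 q' + length (block 1 b)) sq)))))))
    where
    x2 : digit e 2 ≡ false
    x2 = digit-after-one {e} Ae 1 x
    p2 : partialVal 2 e ≡ 2
    p2 = trans (partialVal-true e 1 x) (cong (_+ 2) (partialVal-false e 0 e0))
    sq : sᵇ q' ≡ true
    sq = trans (proj₂ S1) (cong not x2)
  ... | inj₂ x = fin (trans (cong suc (proj₁ S1)) (trans (cong (λ z → suc (z + blockStart 1 q')) p2)
          (trans (+-comm 1 (blockStart 1 q')) (sym (trans (+-identityʳ _) (trans (blockStart-suc 1 q') (cong (λ b → blockStart 1 q' + length (block 1 b)) sq)))))))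
    where
    x1 : digit e 1 ≡ false
    x1 = digit-before-one {e} Ae 1 x
    p2 : partialVal 2 e ≡ 0
    p2 = trans (partialVal-false e 1 x1) (partialVal-false e 0 e0)
    sq : sᵇ q' ≡ false
    sq = trans (proj₂ S1) (cong not x)

sumFin-cong : ∀ {n} {g h : Fin n → ℤ} → (∀ i → g i ≡ h i) → sumFin g ≡ sumFin h
sumFin-cong {zero}  e = refl
sumFin-cong {suc n} e = cong₂ _+ℤ_ (e Fin.zero) (sumFin-cong (λ i → e (Fin.suc i)))

sumFin-*ˡ : ∀ {n} c (g : Fin n → ℤ) → sumFin (λ i → c *ℤ g i) ≡ c *ℤ sumFin g
sumFin-*ˡ {zero}  c g = sym (ℤ.*-zeroʳ c)
sumFin-*ˡ {suc n} c g = trans (cong (c *ℤ g Fin.zero +ℤ_) (sumFin-*ˡ c (λ i → g (Fin.suc i))))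
                              (sym (ℤ.*-distribˡ-+ c (g Fin.zero) _))

sumFin-last : ∀ {n} (g : Fin (suc n) → ℤ) → sumFin g ≡ sumFin (λ i → g (inject₁ i)) +ℤ g (fromℕ n)
sumFin-last {zero}  g = trans (ℤ.+-identityʳ (g Fin.zero)) (sym (ℤ.+-identityˡ (g Fin.zero)))
sumFin-last {suc n} g = trans (cong (g Fin.zero +ℤ_) (sumFin-last (λ i → g (Fin.suc i))))
                              (sym (ℤ.+-assoc (g Fin.zero) _ _))

det-cong : ∀ {n} {M N : Fin n → Fin n → ℤ} → (∀ i j → M i j ≡ N i j) → det M ≡ det N
det-cong {zero}  e = refl
det-cong {suc n} e = sumFin-cong (λ i → cong₂ (λ a b → sgn (toℕ i) *ℤ (a *ℤ b))
  (e i Fin.zero) (det-cong (λ p q → e (punchIn i p) (Fin.suc q))))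

sgn-+ : ∀ a b → sgn (a + b) ≡ sgn a *ℤ sgn b
sgn-+ zero    b = sym (ℤ.*-identityˡ (sgn b))
sgn-+ (suc a) b = trans (cong -_ (sgn-+ a b)) (ℤ.neg-distribˡ-* (sgn a) (sgn b))

sgn-*-sgn : ∀ a → sgn a *ℤ sgn a ≡ 1ℤ
sgn-*-sgn zero    = refl
sgn-*-sgn (suc a) = trans (neg-*-neg (sgn a)) (sgn-*-sgn a)
  where
  neg-*-neg : ∀ x → (- x) *ℤ (- x) ≡ x *ℤ x
  neg-*-neg = solve-∀ℤ

sgn-double : ∀ a → sgn (a + a) ≡ 1ℤ
sgn-double a = trans (sgn-+ a a) (sgn-*-sgn a)

rotateRows : ∀ {n} {A : Set} → (Fin (suc n) → A) → Fin (suc n) → A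
rotateRows {n} M Fin.zero    = M (fromℕ n)
rotateRows     M (Fin.suc i) = M (inject₁ i)

punchIn-fromℕ : ∀ {n} (p : Fin n) → punchIn (fromℕ n) p ≡ inject₁ p
punchIn-fromℕ {suc n} Fin.zero    = refl
punchIn-fromℕ {suc n} (Fin.suc p) = cong Fin.suc (punchIn-fromℕ p)

punchIn-inject₁-fromℕ : ∀ {n} (i : Fin (suc n)) → punchIn (inject₁ i) (fromℕ n) ≡ fromℕ (suc n)
punchIn-inject₁-fromℕ {n}     Fin.zero    = refl
punchIn-inject₁-fromℕ {suc n} (Fin.suc i) = cong Fin.suc (punchIn-inject₁-fromℕ i)

inject₁-punchIn : ∀ {n} (i : Fin (suc n)) (p : Fin n) →
                  inject₁ (punchIn i p) ≡ punchIn (inject₁ i) (inject₁ p)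
inject₁-punchIn Fin.zero p = refl
inject₁-punchIn {suc n} (Fin.suc i) Fin.zero    = refl
inject₁-punchIn {suc n} (Fin.suc i) (Fin.suc p) = cong Fin.suc (inject₁-punchIn i p)

minor : ∀ {n} → Fin (suc n) → (Fin (suc n) → Fin (suc n) → ℤ) → Fin n → Fin n → ℤ
minor i M p q = M (punchIn i p) (Fin.suc q)

cofactorTerm : ∀ {n} → (Fin (suc n) → Fin (suc n) → ℤ) → Fin (suc n) → ℤ
cofactorTerm M i = sgn (toℕ i) *ℤ (M i Fin.zero *ℤ det (minor i M))

-- Moving the last row to the top is a cycle of length n + 1.
det-rotateRows : ∀ {n} (M : Fin (suc n) → Fin (suc n) → ℤ) → det (rotateRows M) ≡ sgn n *ℤ det M
det-rotateRows {zero}  M = sym (ℤ.*-identityˡ _)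
det-rotateRows {suc n} M = begin
  cofactorTerm (rotateRows M) Fin.zero +ℤ sumFin (λ i → cofactorTerm (rotateRows M) (Fin.suc i))
    ≡⟨ cong₂ _+ℤ_ top (sumFin-cong rest) ⟩
  σ *ℤ cofactorTerm M (fromℕ N) +ℤ sumFin (λ i → σ *ℤ cofactorTerm M (inject₁ i))
    ≡⟨ ℤ.+-comm (σ *ℤ cofactorTerm M (fromℕ N)) _ ⟩
  sumFin (λ i → σ *ℤ cofactorTerm M (inject₁ i)) +ℤ σ *ℤ cofactorTerm M (fromℕ N)
    ≡⟨ cong (_+ℤ σ *ℤ cofactorTerm M (fromℕ N)) (sumFin-*ˡ σ (λ i → cofactorTerm M (inject₁ i))) ⟩
  σ *ℤ sumFin (λ i → cofactorTerm M (inject₁ i)) +ℤ σ *ℤ cofactorTerm M (fromℕ N)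
    ≡⟨ sym (ℤ.*-distribˡ-+ σ _ _) ⟩
  σ *ℤ (sumFin (λ i → cofactorTerm M (inject₁ i)) +ℤ cofactorTerm M (fromℕ N))
    ≡⟨ cong (σ *ℤ_) (sym (sumFin-last (cofactorTerm M))) ⟩
  σ *ℤ det M ∎
  where
  open ≡-Reasoning
  N = suc n
  σ = sgn N
  top : cofactorTerm (rotateRows M) Fin.zero ≡ σ *ℤ cofactorTerm M (fromℕ N)
  top = begin
    1ℤ *ℤ (M (fromℕ N) Fin.zero *ℤ det (minor Fin.zero (rotateRows M)))
      ≡⟨ cong (λ d → 1ℤ *ℤ (M (fromℕ N) Fin.zero *ℤ d))
              (det-cong (λ p q → cong (λ r → M r (Fin.suc q)) (sym (punchIn-fromℕ p)))) ⟩
    1ℤ *ℤ (M (fromℕ N) Fin.zero *ℤ det (minor (fromℕ N) M))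
      ≡⟨ cong (_*ℤ (M (fromℕ N) Fin.zero *ℤ det (minor (fromℕ N) M))) (sym (trans (cong (λ t → σ *ℤ sgn t) (toℕ-fromℕ N)) (sgn-*-sgn N))) ⟩
    (σ *ℤ sgn (toℕ (fromℕ N))) *ℤ (M (fromℕ N) Fin.zero *ℤ det (minor (fromℕ N) M))
      ≡⟨ ℤ.*-assoc σ _ _ ⟩
    σ *ℤ cofactorTerm M (fromℕ N) ∎
  minor-rotate : ∀ i p q → minor (Fin.suc i) (rotateRows M) p q ≡ rotateRows (minor (inject₁ i) M) p q
  minor-rotate i Fin.zero    q = cong (λ r → M r (Fin.suc q)) (sym (punchIn-inject₁-fromℕ i))
  minor-rotate i (Fin.suc p) q = cong (λ r → M r (Fin.suc q)) (inject₁-punchIn i p)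
  rest : ∀ i → cofactorTerm (rotateRows M) (Fin.suc i) ≡ σ *ℤ cofactorTerm M (inject₁ i)
  rest i = begin
    (- sgn (toℕ i)) *ℤ (x *ℤ det (minor (Fin.suc i) (rotateRows M)))
      ≡⟨ cong (λ d → (- sgn (toℕ i)) *ℤ (x *ℤ d))
              (trans (det-cong (minor-rotate i)) (det-rotateRows (minor (inject₁ i) M))) ⟩
    (- sgn (toℕ i)) *ℤ (x *ℤ (sgn n *ℤ y))
      ≡⟨ swap-signs (sgn n) (sgn (toℕ i)) x y ⟩
    σ *ℤ (sgn (toℕ i) *ℤ (x *ℤ y))
      ≡⟨ cong (λ t → σ *ℤ (sgn t *ℤ (x *ℤ y))) (sym (toℕ-inject₁ i)) ⟩
    σ *ℤ cofactorTerm M (inject₁ i) ∎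
    where
    x = M (inject₁ i) Fin.zero
    y = det (minor (inject₁ i) M)
    swap-signs : ∀ a b c d → (- b) *ℤ (c *ℤ (a *ℤ d)) ≡ (- a) *ℤ (b *ℤ (c *ℤ d))
    swap-signs = solve-∀ℤ

s-cong : ∀ x y → sᵇ x ≡ sᵇ y → s x ≡ s y
s-cong _ _ = cong (λ b → if b then 1ℤ else 0ℤ)

H-cong : ∀ m m' n → (∀ t → suc t < n + n → sᵇ (m + t) ≡ sᵇ (m' + t)) → H m n ≡ H m' n
H-cong m m' n h = det-cong λ i j →
  trans (cong s (+-assoc m (toℕ i) (toℕ j)))
    (trans (s-cong (m + (toℕ i + toℕ j)) (m' + (toℕ i + toℕ j)) (h (toℕ i + toℕ j) (entry< i j))) (cong s (sym (+-assoc m' (toℕ i) (toℕ j)))))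
  where
  entry< : ∀ (i j : Fin n) → suc (toℕ i + toℕ j) < n + n
  entry< i j = subst (_≤ n + n) (+-suc (suc (toℕ i)) (toℕ j)) (+-mono-≤ (toℕ<n i) (toℕ<n j))

H-suc : ∀ m n → (∀ j → j < suc n → sᵇ (m + suc n + j) ≡ sᵇ (m + j)) →
        H (suc m) (suc n) ≡ sgn n *ℤ H m (suc n)
H-suc m n periodic = begin
  det M'                              ≡⟨ sym (ℤ.*-identityˡ _) ⟩
  1ℤ *ℤ det M'                       ≡⟨ cong (_*ℤ det M') (sym (sgn-*-sgn n)) ⟩
  (sgn n *ℤ sgn n) *ℤ det M'          ≡⟨ ℤ.*-assoc (sgn n) (sgn n) (det M') ⟩
  sgn n *ℤ (sgn n *ℤ det M')          ≡⟨ cong (sgn n *ℤ_) (sym (det-rotateRows M')) ⟩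
  sgn n *ℤ det (rotateRows M')        ≡⟨ cong (sgn n *ℤ_) (det-cong rows) ⟩
  sgn n *ℤ det M                      ∎
  where
  open ≡-Reasoning
  M' M : Fin (suc n) → Fin (suc n) → ℤ
  M' i j = s (suc m + toℕ i + toℕ j)
  M  i j = s (m + toℕ i + toℕ j)
  rows : ∀ i j → rotateRows M' i j ≡ M i j
  rows Fin.zero j = begin
    s (suc m + toℕ (fromℕ n) + toℕ j) ≡⟨ cong (λ z → s (suc m + z + toℕ j)) (toℕ-fromℕ n) ⟩
    s (suc m + n + toℕ j)             ≡⟨ cong (λ z → s (z + toℕ j)) (sym (+-suc m n)) ⟩
    s (m + suc n + toℕ j)             ≡⟨ s-cong (m + suc n + toℕ j) (m + toℕ j) (periodic (toℕ j) (toℕ<n j)) ⟩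
    s (m + toℕ j)                     ≡⟨ cong (λ z → s (z + toℕ j)) (sym (+-identityʳ m)) ⟩
    s (m + 0 + toℕ j)                 ∎
  rows (Fin.suc i) j = trans (cong (λ z → s (suc m + z + toℕ j)) (toℕ-inject₁ i))
                             (cong (λ z → s (z + toℕ j)) (sym (+-suc m (toℕ i))))

H-suc-periodic : ∀ m N n₀ → N ≡ suc n₀ → (∀ j → j < N → sᵇ (m + N + j) ≡ sᵇ (m + j)) → H (suc m) N ≡ sgn n₀ *ℤ H m N
H-suc-periodic m N n₀ refl = H-suc m n₀

H-suc-fe : ∀ m k → (∀ j → j < fe k → sᵇ (m + fe k + j) ≡ sᵇ (m + j)) → H (suc m) (fe k) ≡ H m (fe k)
H-suc-fe m k h = trans (H-suc-periodic m (fe k) _ (fe≡1+fe/2+fe/2 k) h) (trans (cong (_*ℤ H m (fe k)) (sgn-double (fe/2 k))) (ℤ.*-identityˡ _))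

H-suc-fo : ∀ m k → (∀ j → j < fo k → sᵇ (m + fo k + j) ≡ sᵇ (m + j)) → H (suc m) (fo k) ≡ - H m (fo k)
H-suc-fo m k h = trans (H-suc-periodic m (fo k) _ eq h)
  (trans (cong (_*ℤ H m (fo k)) sg) (trans (sym (ℤ.neg-distribˡ-* 1ℤ (H m (fo k)))) (cong -_ (ℤ.*-identityˡ _))))
  where
  h0 = proj₁ (m≤n⇒∃[o]m+o≡n (1≤fo/2 k))
  e0 : suc h0 ≡ fo/2 k
  e0 = proj₂ (m≤n⇒∃[o]m+o≡n (1≤fo/2 k))
  eq : fo k ≡ suc (suc (h0 + h0))
  eq = trans (fo≡fo/2+fo/2 k) (trans (cong (λ z → z + z) (sym e0)) (cong suc (+-suc h0 h0)))
  sg : sgn (suc (h0 + h0)) ≡ - 1ℤ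
  sg = cong -_ (sgn-double h0)

constant-chain : (F : ℕ → ℤ) (c : ℕ) → (∀ r → 1 ≤ r → r < c → F r ≡ F (suc r)) →
                 ∀ r → 1 ≤ r → r ≤ c → F r ≡ F c
constant-chain F c step r 1≤r r≤c = go (≤⇒≤′ r≤c) ≤-refl
  where
  go : ∀ {c′} → r ≤′ c′ → c′ ≤ c → F r ≡ F c′
  go (≤′-reflexive refl) _    = refl
  go (≤′-step {c′} r≤′c′) c′<c =
    trans (go r≤′c′ (<⇒≤ c′<c)) (step c′ (≤-trans 1≤r (≤′⇒≤ r≤′c′)) c′<c)

module PartIα (k q q₁ : ℕ) (sq : sᵇ q ≡ true) (sq₁ : sᵇ q₁ ≡ true) where
  B = blockStart (suc (suc k)) q
  B₁ = blockStart (suc (suc k)) q₁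
  a = fe k
  c = fo k
  h = fo/2 k
  a' = fe (suc k)
  c' = fo (suc k)
  a'' = fe (suc (suc k))

  in-block : ∀ t → t < a'' → sᵇ (B + t) ≡ sᵇ t
  in-block t p = sᵇ-block-true (suc (suc k)) q t sq p

  in-block₁ : ∀ t → t < a'' → sᵇ (B₁ + t) ≡ sᵇ t
  in-block₁ t p = sᵇ-block-true (suc (suc k)) q₁ t sq₁ p

  h<c : h < c
  h<c = fo/2<fo k

  fe-periodic : ∀ v → h < v → suc v < c' + h → sᵇ (v + a) ≡ sᵇ v
  fe-periodic v hv hv2 with <⊎≡+ c v
  ... | inj₁ v<c = trans (cong sᵇ (+-comm v a)) (sᵇ-shift-fe-high k v hv v<c)
  ... | inj₂ (t0 , refl) with <⊎≡+ a t0
  ...   | inj₁ t0<a = trans (cong sᵇ (l1 c t0 a)) (trans (sᵇ-shift-fe-suc k t0 t0<a) (sym (sᵇ-shift-fo k t0 t0<a)))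
    where
    l1 : ∀ c t a → c + t + a ≡ (a + c) + t
    l1 = solve-∀
  ...   | inj₂ (t1 , refl) with <⊎≡+ a t1
  ...     | inj₁ t1<a = trans (cong sᵇ (l2 c a t1)) (trans (sᵇ-shift-fo (suc k) t1 (≤-trans t1<a (m≤m+n a c)))
              (sym (trans (cong sᵇ (l3 c a t1)) (sᵇ-shift-fe-suc k t1 t1<a))))
    where
    l2 : ∀ c a t → c + (a + t) + a ≡ (a + (a + c)) + t
    l2 = solve-∀
    l3 : ∀ c a t → c + (a + t) ≡ (a + c) + t
    l3 = solve-∀
  ...     | inj₂ (t2 , refl) = trans (cong sᵇ (l4 c a t2)) (trans (sᵇ-shift-fo (suc k) (a + t2) (+-monoʳ-< a t2<c)) (trans (sᵇ-shift-fe-low k t2 st2)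
              (sym (trans (cong sᵇ (l5 c a t2)) (sᵇ-shift-fo (suc k) t2 (≤-trans t2<c (m≤n+m c a)))))))
    where
    l4 : ∀ c a t → c + (a + (a + t)) + a ≡ (a + (a + c)) + (a + t)
    l4 = solve-∀
    l5 : ∀ c a t → c + (a + (a + t)) ≡ (a + (a + c)) + t
    l5 = solve-∀
    l6 : ∀ c a t → suc (c + (a + (a + t))) ≡ (a + (a + c)) + suc t
    l6 = solve-∀
    st2 : suc t2 < h
    st2 = +-cancelˡ-< (a + (a + c)) (suc t2) h (subst (_< a + (a + c) + h) (l6 c a t2) hv2)
    t2<c : t2 < c
    t2<c = <-trans (≤-trans (n≤1+n _) st2) h<c

  Hα : ℕ → ℤ
  Hα r = H (B + h + r) a

  Hα-step : ∀ r → 1 ≤ r → r < a' → Hα r ≡ Hα (suc r)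
  Hα-step r p1 p2 = sym (trans (cong (λ z → H z a) (+-suc (B + h) r)) (H-suc-fe (B + h + r) k cond))
    where
    l1 : ∀ B h r a j → B + h + r + a + j ≡ B + (h + r + j + a)
    l1 = solve-∀
    l2 : ∀ B h r j → B + h + r + j ≡ B + (h + r + j)
    l2 = solve-∀
    l3 : ∀ h r j → suc (h + r + j) ≡ suc (r + j) + h
    l3 = solve-∀
    l7 : ∀ h r j a → h + r + j + a ≡ (r + j) + (h + a)
    l7 = solve-∀
    cond : ∀ j → j < a → sᵇ (B + h + r + a + j) ≡ sᵇ (B + h + r + j)
    cond j pj = trans (cong sᵇ (l1 B h r a j)) (trans (in-block (h + r + j + a) b1) (trans (fe-periodic (h + r + j) hv hv2)
                  (trans (sym (in-block (h + r + j) (≤-trans (m≤m+n (suc (h + r + j)) a) b1))) (cong sᵇ (sym (l2 B h r j))))))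
      where
      hv : h < h + r + j
      hv = ≤-trans (subst (_≤ h + r) (+-comm h 1) (+-monoʳ-≤ h p1)) (m≤m+n (h + r) j)
      rj : suc (r + j) < a + a'
      rj = subst (suc (r + j) <_) (+-comm a' a) (subst (λ x → suc x ≤ a' + a) (+-suc r j) (+-mono-≤ p2 pj))
      hv2 : suc (h + r + j) < c' + h
      hv2 = subst (_< c' + h) (sym (l3 h r j)) (+-monoˡ-< h rj)
      ha : h + a ≤ a'
      ha = subst (h + a ≤_) (+-comm c a) (+-monoˡ-≤ a (<⇒≤ h<c))
      b1 : h + r + j + a < a''
      b1 = subst (_< a'') (sym (l7 h r j a)) (≤-trans (n≤1+n _)
             (subst (suc (suc (r + j)) + (h + a) ≤_) (+-comm (a + a') a')
               (≤-trans (+-monoˡ-≤ (h + a) rj) (+-monoʳ-≤ (a + a') ha))))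

  Hα-end : Hα a' ≡ H (B₁ + h + a') a
  Hα-end = H-cong (B + h + a') (B₁ + h + a') a λ t p →
    trans (cong sᵇ (+-assoc (B + h) a' t)) (trans (cong sᵇ (+-assoc B h (a' + t))) (trans (in-block _ (bd t p))
      (sym (trans (cong sᵇ (+-assoc (B₁ + h) a' t)) (trans (cong sᵇ (+-assoc B₁ h (a' + t))) (in-block₁ _ (bd t p)))))))
    where
    bd : ∀ t → suc t < a + a → h + (a' + t) < a''
    bd t p = subst (_< a'') (sym (lm h a' t)) (+-monoʳ-< a' s2)
      where
      ha : h + a ≤ a'
      ha = subst (h + a ≤_) (+-comm c a) (+-monoˡ-≤ a (<⇒≤ h<c))
      s1 : h + t < h + a + a
      s1 = subst (h + t <_) (sym (+-assoc h a a)) (+-monoʳ-< h (≤-trans (n≤1+n _) p))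
      s2 : h + t < a + a'
      s2 = <-≤-trans s1 (subst (h + a + a ≤_) (+-comm a' a) (+-monoˡ-≤ a ha))
      lm : ∀ h a' t → h + (a' + t) ≡ a' + (h + t)
      lm = solve-∀

module PartIβ (k q q₁ : ℕ) (sq : sᵇ q ≡ true) (sq1 : sᵇ (suc q) ≡ true) (sq₁ : sᵇ q₁ ≡ true) where
  B = blockStart (suc k) q
  B₁ = blockStart (suc (suc k)) q₁
  a = fe k
  c = fo k
  h = fo/2 k
  a' = fe (suc k)

  in-block : ∀ t → t < a' → sᵇ (B + t) ≡ sᵇ t
  in-block t p = sᵇ-block-true (suc k) q t sq p

  in-next-block : ∀ t → t < a' → sᵇ (B + a' + t) ≡ sᵇ t
  in-next-block t p = trans (cong (λ z → sᵇ (z + t)) (sym (blockStart-suc-true (suc k) q sq))) (sᵇ-block-true (suc k) (suc q) t sq1 p)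

  in-block₁ : ∀ t → t < fe (suc (suc k)) → sᵇ (B₁ + t) ≡ sᵇ t
  in-block₁ t p = sᵇ-block-true (suc (suc k)) q₁ t sq₁ p

  h<c : h < c
  h<c = fo/2<fo k

  fe-periodic : ∀ v → h < v → suc v < a' + h → sᵇ (B + (v + a)) ≡ sᵇ (B + v)
  fe-periodic v hv hv2 with <⊎≡+ c v
  ... | inj₁ v<c = trans (in-block (v + a) (subst (v + a <_) (+-comm c a) (+-monoˡ-< a v<c)))
        (trans (cong sᵇ (+-comm v a)) (trans (sᵇ-shift-fe-high k v hv v<c) (sym (in-block v (≤-trans v<c (m≤n+m c a))))))
  ... | inj₂ (t0 , refl) with <⊎≡+ a t0
  ...   | inj₁ t0<a = trans (cong sᵇ (l1 B c t0 a)) (trans (in-next-block t0 (≤-trans t0<a (m≤m+n a c)))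
          (sym (trans (in-block (c + t0) (subst (c + t0 <_) (+-comm c a) (+-monoʳ-< c t0<a))) (sᵇ-shift-fo k t0 t0<a))))
    where
    l1 : ∀ B c t a → B + (c + t + a) ≡ B + (a + c) + t
    l1 = solve-∀
  ...   | inj₂ (t1 , refl) = trans (cong sᵇ (l2 B c a t1)) (trans (in-next-block (a + t1) (+-monoʳ-< a t1<c)) (trans (sᵇ-shift-fe-low k t1 st1)
          (sym (trans (cong sᵇ (l3 B c a t1)) (in-next-block t1 (≤-trans t1<c (m≤n+m c a)))))))
    where
    l2 : ∀ B c a t → B + (c + (a + t) + a) ≡ B + (a + c) + (a + t)
    l2 = solve-∀
    l3 : ∀ B c a t → B + (c + (a + t)) ≡ B + (a + c) + t
    l3 = solve-∀
    l4 : ∀ c a t → suc (c + (a + t)) ≡ (a + c) + suc t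
    l4 = solve-∀
    st1 : suc t1 < h
    st1 = +-cancelˡ-< (a + c) (suc t1) h (subst (_< a + c + h) (l4 c a t1) hv2)
    t1<c : t1 < c
    t1<c = <-trans (≤-trans (n≤1+n _) st1) h<c

  Hβ : ℕ → ℤ
  Hβ r = H (B + h + r) a

  Hβ-step : ∀ r → 1 ≤ r → r < c → Hβ r ≡ Hβ (suc r)
  Hβ-step r p1 p2 = sym (trans (cong (λ z → H z a) (+-suc (B + h) r)) (H-suc-fe (B + h + r) k cond))
    where
    l1 : ∀ B h r a j → B + h + r + a + j ≡ B + (h + r + j + a)
    l1 = solve-∀
    l2 : ∀ B h r j → B + h + r + j ≡ B + (h + r + j)
    l2 = solve-∀
    l3 : ∀ h r j → suc (h + r + j) ≡ suc (r + j) + h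
    l3 = solve-∀
    cond : ∀ j → j < a → sᵇ (B + h + r + a + j) ≡ sᵇ (B + h + r + j)
    cond j pj = trans (cong sᵇ (l1 B h r a j)) (trans (fe-periodic (h + r + j) hv hv2) (cong sᵇ (sym (l2 B h r j))))
      where
      hv : h < h + r + j
      hv = ≤-trans (subst (_≤ h + r) (+-comm h 1) (+-monoʳ-≤ h p1)) (m≤m+n (h + r) j)
      rj : suc (r + j) < a'
      rj = subst (suc (r + j) <_) (+-comm c a) (subst (λ x → suc x ≤ c + a) (+-suc r j) (+-mono-≤ p2 pj))
      hv2 : suc (h + r + j) < a' + h
      hv2 = subst (_< a' + h) (sym (l3 h r j)) (+-monoˡ-< h rj)

  Hβ-end : Hβ c ≡ H (B₁ + h + a') a
  Hβ-end = H-cong (B + h + c) (B₁ + h + a') a W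
    where
    W : ∀ t → suc t < a + a → sᵇ (B + h + c + t) ≡ sᵇ (B₁ + h + a' + t)
    W t p with <⊎≡+ a (h + t)
    ... | inj₁ w<a =
      trans (cong sᵇ (l1 B h c t)) (trans (in-block (c + (h + t)) (subst (c + (h + t) <_) (+-comm c a) (+-monoʳ-< c w<a)))
        (trans (sᵇ-shift-fo k (h + t) w<a)
          (sym (trans (cong sᵇ (l1 B₁ h a' t))
            (trans (in-block₁ (a' + (h + t)) (+-monoʳ-< a' (≤-trans w<a (m≤m+n a a')))) (sᵇ-shift-fe-suc k (h + t) w<a))))))
      where
      l1 : ∀ B h c t → B + h + c + t ≡ B + (c + (h + t))
      l1 = solve-∀
    ... | inj₂ (w' , e) = trans (cong sᵇ (l2 B h c t a w' e)) (trans (in-next-block w' w'<) (sym (trans (cong sᵇ (l3 B₁ h a' t a w' e))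
          (trans (in-block₁ (fo (suc k) + w') (subst (fo (suc k) + w' <_) (+-comm (fo (suc k)) a') (+-monoʳ-< (fo (suc k)) w'<))) (sᵇ-shift-fo (suc k) w' w'<)))))
      where
      l2 : ∀ B h c t a w → h + t ≡ a + w → B + h + c + t ≡ B + (a + c) + w
      l2 B h c t a w e = trans (lem B h c t) (trans (cong (λ z → B + c + z) e) (lem2 B c a w))
        where
        lem : ∀ B h c t → B + h + c + t ≡ B + c + (h + t)
        lem = solve-∀
        lem2 : ∀ B c a w → B + c + (a + w) ≡ B + (a + c) + w
        lem2 = solve-∀
      l3 : ∀ B h a' t a w → h + t ≡ a + w → B + h + a' + t ≡ B + (a + a' + w)
      l3 B h a' t a w e = trans (lem B h a' t) (trans (cong (λ z → B + a' + z) e) (lem2 B a' a w))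
        where
        lem : ∀ B h c t → B + h + c + t ≡ B + c + (h + t)
        lem = solve-∀
        lem2 : ∀ B c a w → B + c + (a + w) ≡ B + (a + c + w)
        lem2 = solve-∀
      w'< : w' < a'
      w'< = <-≤-trans (+-cancelˡ-< a w' (h + a) s1) (subst (h + a ≤_) (+-comm c a) (+-monoˡ-≤ a (<⇒≤ h<c)))
        where
        lh : ∀ h a → h + (a + a) ≡ a + (h + a)
        lh = solve-∀
        s1 : a + w' < a + (h + a)
        s1 = subst (_< a + (h + a)) e (subst (h + t <_) (lh h a) (+-monoʳ-< h (≤-trans (n≤1+n _) p)))

module PartII (k q : ℕ) (sq : sᵇ q ≡ true) where
  B = blockStart (suc k) q
  a = fe k
  c = fo k
  h = fo/2 k
  a' = fe (suc k)

  in-block : ∀ t → t < a' → sᵇ (B + t) ≡ sᵇ t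
  in-block t p = sᵇ-block-true (suc k) q t sq p

  in-next-block : ∀ t → t < a → sᵇ (B + a' + t) ≡ sᵇ t
  in-next-block t p = trans (cong (λ z → sᵇ (z + t)) (sym (blockStart-suc-true (suc k) q sq))) (sᵇ-next-block k q t p)

  h<c : h < c
  h<c = fo/2<fo k
  c≡ : c ≡ h + h
  c≡ = fo≡fo/2+fo/2 k
  h≤a : h ≤ a
  h≤a = fo/2≤fe k

  previous-A : ∀ w → 1 ≤ w → ∀ P → P + w ≡ B → Σ ℕ (λ X → B ≡ X + a × (∀ t → t < a → sᵇ (X + t) ≡ sᵇ t))
  previous-A w pw P e = block-ends-with-A-nonempty k q (subst (1 ≤_) e (≤-trans pw (m≤n+m w P)))

  fe-periodic : ∀ P v → P + h ≡ B + v → 1 ≤ v → suc v < a' → sᵇ (P + c) ≡ sᵇ P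
  fe-periodic P v e pv pv2 with <⊎≡+ h v
  ... | inj₂ (u , refl) = subst (λ z → sᵇ (z + c) ≡ sᵇ z) (sym eP) (per2 u su)
    where
    eP : P ≡ B + u
    eP = +-cancelʳ-≡ h P (B + u) (trans e (lm B h u))
      where
      lm : ∀ B h u → B + (h + u) ≡ B + u + h
      lm = solve-∀
    su : suc u < a + h
    su = +-cancelʳ-< h (suc u) (a + h) (subst (_< a + h + h) (lm2 h u) (subst (suc (h + u) <_) (lm3 a c h c≡) pv2))
      where
      lm2 : ∀ h u → suc (h + u) ≡ suc u + h
      lm2 = solve-∀
      lm3 : ∀ a c h → c ≡ h + h → a + c ≡ a + h + h
      lm3 a c h e = trans (cong (a +_) e) (sym (+-assoc a h h))
    per2 : ∀ u → suc u < a + h → sᵇ (B + u + c) ≡ sᵇ (B + u)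
    per2 u su with <⊎≡+ a u
    ... | inj₁ u<a = trans (cong sᵇ (trans (+-assoc B u c) (cong (B +_) (+-comm u c))))
           (trans (in-block (c + u) (subst (c + u <_) (+-comm c a) (+-monoʳ-< c u<a))) (trans (sᵇ-shift-fo k u u<a) (sym (in-block u (≤-trans u<a (m≤m+n a c)))))) 
    ... | inj₂ (t , refl) = trans (cong sᵇ (lm B a t c)) (trans (in-next-block t (<-≤-trans (≤-trans (n≤1+n _) st) h≤a))
           (sym (trans (in-block (a + t) (+-monoʳ-< a (<-trans (≤-trans (n≤1+n _) st) h<c))) (sᵇ-shift-fe-low k t st))))
      where
      lm : ∀ B a t c → B + (a + t) + c ≡ B + (a + c) + t
      lm = solve-∀
      st : suc t < h
      st = +-cancelˡ-< a (suc t) h (subst (_< a + h) (sym (+-suc a t)) su)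
  ... | inj₁ v<h = trans (cong sᵇ (trans (cong (_+ c) eP) (trans (lmA X z c a y e2) (cong (_+ y) (sym eX))))) (trans (in-block y (≤-trans y<c (m≤n+m c a)))
       (sym (trans (cong sᵇ eP) (trans (EX z z<a) (trans (sym (sᵇ-shift-fo k z z<a)) (trans (cong sᵇ e2) (sᵇ-shift-fe-high k y hy y<c)))))))
    where
    w' = proj₁ (m≤n⇒∃[o]m+o≡n v<h)
    ew : suc v + w' ≡ h
    ew = proj₂ (m≤n⇒∃[o]m+o≡n v<h)
    e1 : P + suc w' ≡ B
    e1 = +-cancelʳ-≡ v (P + suc w') B (trans (lm P v w') (trans (cong (P +_) ew) e))
      where
      lm : ∀ P v w → P + suc w + v ≡ P + (suc v + w)
      lm = solve-∀
    pr = previous-A (suc w') (s≤s z≤n) P e1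
    X = proj₁ pr
    eX : B ≡ X + a
    eX = proj₁ (proj₂ pr)
    EX = proj₂ (proj₂ pr)
    sw≤a : suc w' ≤ a
    sw≤a = ≤-trans (subst (suc w' ≤_) ew (s≤s (m≤n+m w' v))) h≤a
    z = proj₁ (m≤n⇒∃[o]m+o≡n sw≤a)
    ez : suc w' + z ≡ a
    ez = proj₂ (m≤n⇒∃[o]m+o≡n sw≤a)
    eP : P ≡ X + z
    eP = +-cancelʳ-≡ (suc w') P (X + z) (trans e1 (trans eX (trans (cong (X +_) (sym ez)) (lm X w' z))))
      where
      lm : ∀ X w z → X + (suc w + z) ≡ X + z + suc w
      lm = solve-∀
    z<a : z < a
    z<a = subst (z <_) ez (s≤s (m≤n+m z w'))
    y = v + h
    e2 : c + z ≡ a + y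
    e2 = rearrange v w' z h a c ew ez c≡
      where
      rearrange : ∀ v w z h a c → suc v + w ≡ h → suc w + z ≡ a → c ≡ h + h → c + z ≡ a + (v + h)
      rearrange v w z _ _ _ refl refl refl = lm v w z
        where
        lm : ∀ v w z → suc v + w + (suc v + w) + z ≡ suc w + z + (v + (suc v + w))
        lm = solve-∀
    lmA : ∀ X z c a y → c + z ≡ a + y → X + z + c ≡ X + a + y
    lmA X z c a y e = trans (+-assoc X z c) (trans (cong (X +_) (trans (+-comm z c) e)) (sym (+-assoc X a y)))
    hy : h < y
    hy = subst (h <_) (+-comm h v) (subst (_≤ h + v) (+-comm h 1) (+-monoʳ-≤ h pv))
    y<c : y < c
    y<c = subst (y <_) (sym c≡) (+-monoˡ-< h v<h)

  start : ℕ → ℕ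
  start r = (B + r) ∸ h

  Hγ : ℕ → ℤ
  Hγ r = H (start r) c

  Hγ-step : ∀ r → 1 ≤ r → r < a → h ≤ B + r → Hγ (suc r) ≡ - Hγ r
  Hγ-step r p1 p2 hB = trans (cong (λ z → H z c) (trans (cong (_∸ h) (+-suc B r)) (+-∸-assoc 1 hB))) (H-suc-fo (start r) k cond)
    where
    ePr : start r + h ≡ B + r
    ePr = m∸n+n≡m hB
    cond : ∀ j → j < c → sᵇ (start r + c + j) ≡ sᵇ (start r + j)
    cond j pj = trans (cong sᵇ (lm (start r) c j)) (fe-periodic (start r + j) (r + j) e' (≤-trans p1 (m≤m+n r j)) b)
      where
      lm : ∀ P c j → P + c + j ≡ P + j + c
      lm = solve-∀
      lm2 : ∀ P j h → P + j + h ≡ P + h + j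
      lm2 = solve-∀
      e' : start r + j + h ≡ B + (r + j)
      e' = trans (lm2 (start r) j h) (trans (cong (_+ j) ePr) (+-assoc B r j))
      b : suc (r + j) < a'
      b = subst (λ x → suc x ≤ a + c) (+-suc r j) (+-mono-≤ p2 pj)

  sgn-fe+1 : sgn (a + 1) ≡ 1ℤ
  sgn-fe+1 = trans (cong sgn (trans (+-comm a 1) (cong suc (fe≡1+fe/2+fe/2 k)))) (trans (cong (λ x → - - x) (sgn-double (fe/2 k))) (ℤ.neg-involutive 1ℤ))

  Hγ-alternating′ : ∀ d r → r + d ≡ a → 1 ≤ r → h ≤ B + r → Hγ r ≡ sgn (r + 1) *ℤ Hγ a
  Hγ-alternating′ zero r e p1 hB rewrite trans (sym (+-identityʳ r)) e =
    sym (trans (cong (_*ℤ Hγ a) sgn-fe+1) (ℤ.*-identityˡ _))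
  Hγ-alternating′ (suc d) r e p1 hB = begin
    Hγ r ≡⟨ sym (ℤ.neg-involutive (Hγ r)) ⟩
    - (- Hγ r) ≡⟨ cong -_ (sym (Hγ-step r p1 r<a hB)) ⟩
    - Hγ (suc r) ≡⟨ cong -_ (Hγ-alternating′ d (suc r) (trans (sym (+-suc r d)) e) (s≤s z≤n) (≤-trans hB (+-monoʳ-≤ B (n≤1+n r)))) ⟩
    - (sgn (suc r + 1) *ℤ Hγ a) ≡⟨ ℤ.neg-distribˡ-* (sgn (suc r + 1)) (Hγ a) ⟩
    (- sgn (suc r + 1)) *ℤ Hγ a ≡⟨⟩
    (- sgn (suc (r + 1))) *ℤ Hγ a ≡⟨ cong (_*ℤ Hγ a) (ℤ.neg-involutive (sgn (r + 1))) ⟩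
    sgn (r + 1) *ℤ Hγ a ∎
    where
    open ≡-Reasoning
    r<a : r < a
    r<a = subst (r <_) e (subst (_≤ r + suc d) (+-comm r 1) (+-monoʳ-≤ r (s≤s z≤n)))

  Hγ-alternating : ∀ r → 1 ≤ r → r ≤ a → h ≤ B + r → Hγ r ≡ sgn (r + 1) *ℤ Hγ a
  Hγ-alternating r 1≤r r≤a = Hγ-alternating′ (proj₁ (m≤n⇒∃[o]m+o≡n r≤a)) r (proj₂ (m≤n⇒∃[o]m+o≡n r≤a)) 1≤r

sᵇ-after-block-true : ∀ k q → sᵇ q ≡ true → ∀ u → u < fe (suc k) + fe k →
                      sᵇ (blockStart (suc k) q + u) ≡ sᵇ u
sᵇ-after-block-true k q sq u u< with <⊎≡+ (fe (suc k)) u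
... | inj₁ u<a' = sᵇ-block-true (suc k) q u sq u<a'
... | inj₂ (t , refl) = begin
  sᵇ (blockStart (suc k) q + (fe (suc k) + t)) ≡⟨ cong sᵇ (sym (+-assoc (blockStart (suc k) q) (fe (suc k)) t)) ⟩
  sᵇ (blockStart (suc k) q + fe (suc k) + t)   ≡⟨ PartII.in-next-block k q sq t t<fe ⟩
  sᵇ t                                         ≡⟨ sym (sᵇ-shift-fe-suc k t t<fe) ⟩
  sᵇ (fe (suc k) + t)                          ∎
  where
  open ≡-Reasoning
  t<fe : t < fe k
  t<fe = +-cancelˡ-< (fe (suc k)) t (fe k) u<

H-II-at-end : ∀ k q (sq : sᵇ q ≡ true) → PartII.Hγ k q sq (fe k) ≡ H (fe k ∸ fo/2 k) (fo k)
H-II-at-end k q sq = begin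
  H ((B + a) ∸ h) c   ≡⟨ cong (λ z → H z c) (+-∸-assoc B h≤a) ⟩
  H (B + (a ∸ h)) c   ≡⟨ H-cong (B + (a ∸ h)) (a ∸ h) c window ⟩
  H (a ∸ h) c         ∎
  where
  open ≡-Reasoning
  open PartII k q sq using (B; a; c; h; a'; h≤a)
  window< : ∀ t → suc t < c + c → (a ∸ h) + t < a' + a
  window< t p = <-≤-trans (+-monoʳ-< (a ∸ h) (≤-trans (n≤1+n _) p))
    (subst ((a ∸ h) + (c + c) ≤_) (lm a c) (≤-trans (≤-reflexive e3) (+-monoʳ-≤ a (+-monoˡ-≤ c h≤a))))
    where
    lm : ∀ a c → a + (a + c) ≡ a + c + a
    lm = solve-∀
    lm2 : ∀ x h c → x + ((h + h) + c) ≡ (x + h) + (h + c)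
    lm2 = solve-∀
    e3 : (a ∸ h) + (c + c) ≡ a + (h + c)
    e3 = trans (cong (λ z → (a ∸ h) + (z + c)) (fo≡fo/2+fo/2 k))
               (trans (lm2 (a ∸ h) h c) (cong (_+ (h + c)) (m∸n+n≡m h≤a)))
  window : ∀ t → suc t < c + c → sᵇ (B + (a ∸ h) + t) ≡ sᵇ ((a ∸ h) + t)
  window t p = trans (cong sᵇ (+-assoc B (a ∸ h) t)) (sᵇ-after-block-true k q sq _ (window< t p))

E'-suc-∸-fe : ∀ k X → (X + fo/2 (suc (suc k))) ∸ fe k ≡ X + fo/2 k + fe (suc k)
E'-suc-∸-fe k X = trans (cong (_∸ fe k) (lm X (fe k) (fe (suc k)) (fo/2 k))) (m+n∸n≡m _ (fe k))
  where
  lm : ∀ X a a' h → X + (a' + (a + h)) ≡ (X + h + a') + a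
  lm = solve-∀

Nth-member : ∀ {P i x} → Nth P i x → P x
Nth-member (first p _) = p
Nth-member (next _ _ p _) = p

H-E'-shift-constant : ∀ k {α α′} → E' (suc k) α → E' (suc k) α′ →
  ∀ r' → 1 ≤ r' → r' ≤ f (2 * k + 2) →
  H ((α + r') ∸ f (2 * k + 3)) (f (2 * k)) ≡ H (α′ ∸ f (2 * k)) (f (2 * k))
H-E'-shift-constant k α∈ α′∈ r' 1≤r' r'≤ rewrite f-even k | f-2k+3 k
  with E'-in-block (suc k) _ α∈ | E'-in-block (suc k) _ α′∈
... | q , refl , sq | q₁ , refl , sq₁ = begin
  H ((B + (a' + (a + h)) + r') ∸ (a + a')) a ≡⟨ cong (λ z → H z a) (trans (cong (_∸ (a + a')) (lm B a a' h r'))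
                                                                         (m+n∸n≡m (B + h + r') (a + a'))) ⟩
  Hα r'                                      ≡⟨ constant-chain Hα a' Hα-step r' 1≤r' (subst (r' ≤_) (f-2k+2 k) r'≤) ⟩
  Hα a'                                      ≡⟨ Hα-end ⟩
  H (B₁ + h + a') a                          ≡⟨ cong (λ z → H z a) (sym (E'-suc-∸-fe k B₁)) ⟩
  H ((B₁ + fo/2 (suc (suc k))) ∸ a) a        ∎
  where
  open ≡-Reasoning
  open PartIα k q q₁ sq sq₁
  lm : ∀ B a a' h r → B + (a' + (a + h)) + r ≡ (B + h + r) + (a + a')
  lm = solve-∀

H-F''-shift-constant : ∀ k {α β} → E' (suc k) α → F'' k β →
  ∀ r → 1 ≤ r → r ≤ f (2 * k + 1) →
  H (β + r) (f (2 * k)) ≡ H (α ∸ f (2 * k)) (f (2 * k))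
H-F''-shift-constant k α∈ β∈ r 1≤r r≤ rewrite f-even k
  with E'-in-block (suc k) _ α∈ | F''-in-block k _ β∈
... | q₁ , refl , sq₁ | q , refl , sq , sq′ = begin
  Hβ r                                  ≡⟨ constant-chain Hβ c Hβ-step r 1≤r (subst (r ≤_) (f-2k+1 k) r≤) ⟩
  Hβ c                                  ≡⟨ Hβ-end ⟩
  H (B₁ + h + a') a                     ≡⟨ cong (λ z → H z a) (sym (E'-suc-∸-fe k B₁)) ⟩
  H ((B₁ + fo/2 (suc (suc k))) ∸ a) a   ∎
  where
  open ≡-Reasoning
  open PartIβ k q q₁ sq sq′ sq₁

+-∸-+ : ∀ X K h → (X + K) ∸ (K + h) ≡ X ∸ h
+-∸-+ X K h = trans (sym (∸-+-assoc (X + K) K h)) (cong (_∸ h) (m+n∸n≡m X K))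

H-E'-shift-alternating : ∀ k {γ γ′} → E' k γ → E' k γ′ →
  ∀ r → 1 ≤ r → r ≤ f (2 * k) → f (2 * k + 2) ≤ γ + r →
  H ((γ + r) ∸ f (2 * k + 2)) (f (2 * k + 1)) ≡ sgn (r + 1) *ℤ H (γ′ ∸ f (2 * k + 1)) (f (2 * k + 1))
H-E'-shift-alternating k {γ} {γ′} γ∈ γ′∈ r 1≤r r≤ a'≤ rewrite f-2k+1 k
  with E'-in-block k _ γ∈ | E'-in-block k _ γ′∈
... | q , refl , sq | q₁ , refl , sq₁ = begin
  H ((γ + r) ∸ f (2 * k + 2)) c      ≡⟨ cong (λ z → H ((γ + r) ∸ z) c) (f-2k+2 k) ⟩
  H ((γ + r) ∸ a') c                 ≡⟨ cong (λ z → H z c) (trans (cong₂ _∸_ (lm B r) a'≡) (+-∸-+ (B + r) (a + h) h)) ⟩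
  Hγ r                               ≡⟨ Hγ-alternating r 1≤r (subst (r ≤_) (f-even k) r≤) h≤B+r ⟩
  sgn (r + 1) *ℤ Hγ a                ≡⟨ cong (sgn (r + 1) *ℤ_) (H-II-at-end k q sq) ⟩
  sgn (r + 1) *ℤ H (a ∸ h) c         ≡⟨ cong (sgn (r + 1) *ℤ_) (sym (H-II-at-end k q₁ sq₁)) ⟩
  sgn (r + 1) *ℤ PartII.Hγ k q₁ sq₁ a ≡⟨ cong (λ z → sgn (r + 1) *ℤ H z c) (sym γ′∸c) ⟩
  sgn (r + 1) *ℤ H (γ′ ∸ c) c        ∎
  where
  open ≡-Reasoning
  open PartII k q sq
  lm : ∀ B r → B + (a + h) + r ≡ (B + r) + (a + h)
  lm B r = trans (+-assoc B (a + h) r) (trans (cong (B +_) (+-comm (a + h) r)) (sym (+-assoc B r (a + h))))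
  a'≡ : a' ≡ (a + h) + h
  a'≡ = trans (cong (a +_) c≡) (sym (+-assoc a h h))
  h≤B+r : h ≤ B + r
  h≤B+r = +-cancelˡ-≤ (a + h) h (B + r)
    (subst₂ _≤_ (trans (f-2k+2 k) a'≡) (trans (lm B r) (+-comm (B + r) (a + h))) a'≤)
  γ′∸c : γ′ ∸ c ≡ (PartII.B k q₁ sq₁ + a) ∸ h
  γ′∸c = trans (cong₂ _∸_ (sym (+-assoc (PartII.B k q₁ sq₁) a h)) c≡) (+-∸-+ (PartII.B k q₁ sq₁ + a) h h)

proposition4 : (k : ℕ) →
    ((i α₁ α : ℕ) → Nth (E' (suc k)) 1 α₁ → Nth (E' (suc k)) i α →
      (r' : ℕ) → 1 ≤ r' → r' ≤ f (2 * k + 2) →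
      H ((α + r') ∸ f (2 * k + 3)) (f (2 * k)) ≡ H (α₁ ∸ f (2 * k)) (f (2 * k)))
    ×
    ((i α₁ β : ℕ) → Nth (E' (suc k)) 1 α₁ → Nth (F'' k) i β →
      (r : ℕ) → 1 ≤ r → r ≤ f (2 * k + 1) →
      H (β + r) (f (2 * k)) ≡ H (α₁ ∸ f (2 * k)) (f (2 * k)))
    ×
    ((i γ₁ γ : ℕ) → Nth (E' k) 1 γ₁ → Nth (E' k) i γ →
      (r : ℕ) → 1 ≤ r → r ≤ f (2 * k) → f (2 * k + 2) ≤ γ + r →
      H ((γ + r) ∸ f (2 * k + 2)) (f (2 * k + 1))
        ≡ sgn (r + 1) *ℤ H (γ₁ ∸ f (2 * k + 1)) (f (2 * k + 1)))
proposition4 k =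
    (λ _ _ _ α₁ α → H-E'-shift-constant k (Nth-member α) (Nth-member α₁))
  , (λ _ _ _ α₁ β → H-F''-shift-constant k (Nth-member α₁) (Nth-member β))
  , (λ _ _ _ γ₁ γ → H-E'-shift-alternating k (Nth-member γ) (Nth-member γ₁))
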